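{- Let $(\Sigma,P)$ be a string rewrite system. For every proof term $\gamma$ there exists a unique greedy multistep reduction $\gamma'$ such that $\gamma$ and $\gamma'$ are permutation equivalent.
   Context: An alphabet $\Sigma$ has unique reading (if $a_1\cdots a_n=b_1\cdots b_m$ with letters $a_i,b_j$ then $n=m$ and $a_k=b_k$); strings are elements of the free monoid over $\Sigma$ with empty string $\varepsilon$. A string rewrite system $(\Sigma,P)$ has rules $\varrho:\ell\to r$ with $\ell,r$ nonempty strings, treated as nullary symbols. Proof terms are built from $\varepsilon$, letters, rule symbols, juxtaposition $\gamma\delta$ and vertical composition $\gamma\cdot\delta$ (horizontal composition considered modulo the monoid laws), with sources and targets $\gamma:s\Rightarrow t$: $\varepsilon:\varepsilon\Rightarrow\varepsilon$; $a:a\Rightarrow a$; $\varrho:\ell\Rightarrow r$; $\gamma_1\gamma_2:s_1s_2\Rightarrow t_1t_2$ if $\gamma_i:s_i\Rightarrow t_i$; $\gamma\cdot\delta:s\Rightarrow u$ if $\gamma:s\Rightarrow t,\ \delta:t\Rightarrow u$. Permutation equivalence is the congruence on proof terms generated by (both sides required to be proof terms) $\varepsilon\gamma=\gamma$, $\gamma\varepsilon=\gamma$, $(\gamma\delta)\zeta=\gamma(\delta\zeta)$, $s\cdot\gamma=\gamma$, $\gamma\cdot t=\gamma$ (strings $s,t$), $(\gamma\cdot\delta)\cdot\zeta=\gamma\cdot(\delta\cdot\zeta)$, $\gamma\delta\cdot\zeta\eta=(\gamma\cdot\zeta)(\delta\cdot\eta)$. A multistep is a proof term with no vertical composition; step: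 exactly one rule-symbol occurrence; empty: none. A multistep reduction is an empty multistep or a right-associated vertical composition $\Phi_1\cdot(\Phi_2\cdot(\cdots\cdot\Phi_n))$ of nonempty multisteps. For multisteps $\Phi,\Psi$ with the same source, $\Phi\le\Psi$ means $\Phi$ is obtained from $\Psi$ by replacing some rule-symbol occurrences by their left-hand sides; the residual $\Psi/\Phi$ is obtained from $\Psi$ by replacing the other occurrences (those still rules in $\Phi$) by their right-hand sides. A pair $\Phi\cdot\Psi$ of consecutive multisteps is loath if there is a multistep $X$ with the same source as $\Phi$, $\Phi\le X$, such that $\psi:=X/\Phi$ is a step with $\psi\le\Psi$. A multistep reduction is greedy if no pair of consecutive multisteps in it is loath. -}

module Defs where

open import Data.Nat using (ℕ; zero; suc; _+_; _≥_)
open import Data.List using (List; []; _∷_; _++_; map)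
open import Data.Sum using (_⊎_; inj₁; inj₂)
open import Data.Product using (Σ; _×_; _,_; ∃)
open import Data.Unit using (⊤)
open import Relation.Nullary using (¬_)
open import Relation.Binary.PropositionalEquality using (_≡_; _≢_)

-- A string rewrite system (Σ , P).  Strings are elements of the free monoid
-- over the alphabet, i.e. lists of letters (unique reading is automatic).
record SRS : Set₁ where
  field
    Letter : Set
    Rule   : Set
    lhs    : Rule → List Letter
    rhs    : Rule → List Letter
    lhs-nonempty : ∀ ρ → lhs ρ ≢ []
    rhs-nonempty : ∀ ρ → rhs ρ ≢ []

module _ (R : SRS) where
  open SRS R

  Str : Set
  Str = List Letter

  infixl 7 _⊗_
  infixr 6 _⊙_
  data PT : Set where
    ε   : PT
    lt  : Letter → PT
    rl  : Rule → PT
    _⊗_ : PT → PT → PT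
    _⊙_ : PT → PT → PT

  data _∶_⇒_ : PT → Str → Str → Set where
    tε  : ε ∶ [] ⇒ []
    tlt : ∀ a → lt a ∶ (a ∷ []) ⇒ (a ∷ [])
    trl : ∀ ρ → rl ρ ∶ lhs ρ ⇒ rhs ρ
    t⊗  : ∀ {γ δ s₁ s₂ t₁ t₂} → γ ∶ s₁ ⇒ t₁ → δ ∶ s₂ ⇒ t₂ →
          (γ ⊗ δ) ∶ (s₁ ++ s₂) ⇒ (t₁ ++ t₂)
    t⊙  : ∀ {γ δ s t u} → γ ∶ s ⇒ t → δ ∶ t ⇒ u → (γ ⊙ δ) ∶ s ⇒ u

  IsProofTerm : PT → Set
  IsProofTerm γ = Σ Str λ s → Σ Str λ t → γ ∶ s ⇒ t

  data IsString : PT → Set where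
    sε  : IsString ε
    slt : ∀ a → IsString (lt a)
    s⊗  : ∀ {γ δ} → IsString γ → IsString δ → IsString (γ ⊗ δ)

  data Axiom : PT → PT → Set where
    unitˡ  : ∀ γ → Axiom (ε ⊗ γ) γ
    unitʳ  : ∀ γ → Axiom (γ ⊗ ε) γ
    assoc⊗ : ∀ γ δ ζ → Axiom ((γ ⊗ δ) ⊗ ζ) (γ ⊗ (δ ⊗ ζ))
    idˡ    : ∀ s γ → IsString s → Axiom (s ⊙ γ) γ
    idʳ    : ∀ γ t → IsString t → Axiom (γ ⊙ t) γ
    assoc⊙ : ∀ γ δ ζ → Axiom ((γ ⊙ δ) ⊙ ζ) (γ ⊙ (δ ⊙ ζ))
    exch   : ∀ γ δ ζ η → Axiom ((γ ⊗ δ) ⊙ (ζ ⊗ η)) ((γ ⊙ ζ) ⊗ (δ ⊙ η))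

  data _≃_ : PT → PT → Set where
    ax     : ∀ {γ δ} → Axiom γ δ → IsProofTerm γ → IsProofTerm δ → γ ≃ δ
    ≃refl  : ∀ {γ} → IsProofTerm γ → γ ≃ γ
    ≃sym   : ∀ {γ δ} → γ ≃ δ → δ ≃ γ
    ≃trans : ∀ {γ δ ζ} → γ ≃ δ → δ ≃ ζ → γ ≃ ζ
    cong⊗  : ∀ {γ γ' δ δ'} → γ ≃ γ' → δ ≃ δ' → (γ ⊗ δ) ≃ (γ' ⊗ δ')
    cong⊙  : ∀ {γ γ' δ δ'} → γ ≃ γ' → δ ≃ δ' →
             IsProofTerm (γ ⊙ δ) → IsProofTerm (γ' ⊙ δ') → (γ ⊙ δ) ≃ (γ' ⊙ δ')

  -- Multisteps: proof terms without vertical composition, modulo the monoid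
  -- laws of juxtaposition, i.e. strings over letters and rule symbols.
  MS : Set
  MS = List (Letter ⊎ Rule)

  embMS : MS → PT
  embMS [] = ε
  embMS (inj₁ a ∷ Φ) = lt a ⊗ embMS Φ
  embMS (inj₂ ρ ∷ Φ) = rl ρ ⊗ embMS Φ

  src : MS → Str
  src [] = []
  src (inj₁ a ∷ Φ) = a ∷ src Φ
  src (inj₂ ρ ∷ Φ) = lhs ρ ++ src Φ

  tgt : MS → Str
  tgt [] = []
  tgt (inj₁ a ∷ Φ) = a ∷ tgt Φ
  tgt (inj₂ ρ ∷ Φ) = rhs ρ ++ tgt Φ

  #rules : MS → ℕ
  #rules [] = 0
  #rules (inj₁ a ∷ Φ) = #rules Φ
  #rules (inj₂ ρ ∷ Φ) = suc (#rules Φ)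

  IsStep : MS → Set
  IsStep Φ = #rules Φ ≡ 1

  Nonempty : MS → Set
  Nonempty Φ = #rules Φ ≥ 1

  letters : Str → MS
  letters = map inj₁

  data _≤ₘ_ : MS → MS → Set where
    []≤  : [] ≤ₘ []
    keep : ∀ x {Φ Ψ} → Φ ≤ₘ Ψ → (x ∷ Φ) ≤ₘ (x ∷ Ψ)
    drop : ∀ ρ {Φ Ψ} → Φ ≤ₘ Ψ → (letters (lhs ρ) ++ Φ) ≤ₘ (inj₂ ρ ∷ Ψ)

  resid : ∀ {Φ Ψ} → Φ ≤ₘ Ψ → MS
  resid []≤ = []
  resid (keep (inj₁ a) p) = inj₁ a ∷ resid p
  resid (keep (inj₂ ρ) p) = letters (rhs ρ) ++ resid p
  resid (drop ρ p) = inj₂ ρ ∷ resid p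

  Loath : MS → MS → Set
  Loath Φ Ψ = Σ MS λ X → Σ (Φ ≤ₘ X) λ p → IsStep (resid p) × (resid p ≤ₘ Ψ)

  data Chain : Set where
    last : MS → Chain
    _∷c_ : MS → Chain → Chain

  headC : Chain → MS
  headC (last Φ) = Φ
  headC (Φ ∷c c) = Φ

  embChain : Chain → PT
  embChain (last Φ) = embMS Φ
  embChain (Φ ∷c c) = embMS Φ ⊙ embChain c

  WFChain : Chain → Set
  WFChain (last Φ) = Nonempty Φ
  WFChain (Φ ∷c c) = Nonempty Φ × (tgt Φ ≡ src (headC c)) × WFChain c

  GreedyChain : Chain → Set
  GreedyChain (last Φ) = ⊤
  GreedyChain (Φ ∷c c) = ¬ Loath Φ (headC c) × GreedyChain c

  data MSR : Set where
    emptyR : Str → MSR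
    chain  : Chain → MSR

  embMSR : MSR → PT
  embMSR (emptyR s) = embMS (letters s)
  embMSR (chain c) = embChain c

  IsMSR : MSR → Set
  IsMSR (emptyR s) = ⊤
  IsMSR (chain c) = WFChain c

  Greedy : MSR → Set
  Greedy (emptyR s) = ⊤
  Greedy (chain c) = GreedyChain c

  IsGreedyMSR : MSR → Set
  IsGreedyMSR m = IsMSR m × Greedy m

-- Give every letter occurrence a history: the tree of rule applications that produced it.
-- Running a proof term on the histories of its source letters is invariant under permutation
-- equivalence. The level of a history is the depth of that tree, and a multistep reduction is
-- greedy exactly when its i-th multistep contracts precisely the redexes whose inputs have maximal
-- level i; such a layered reduction can be read back from the histories it produces, which gives
-- uniqueness. For existence, a proof term is first rewritten into a sequence of single steps, and
-- these are inserted one at a time into a layered reduction: a step whose inputs have level m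
-- commutes past the layers above m and joins layer m.

module Submission where

open import Defs renaming (drop to drop≤)
open import Data.Empty using (⊥-elim)
open import Data.List using (List; []; _∷_; _++_; map; length; take; drop)
open import Data.List.Properties
  using (map-++; length-map; length-++; ++-assoc; ++-cancelˡ; ++-identityʳ; take++drop≡id; ∷-injective;
         take-drop; drop-drop; take-take; drop-map; take-all)
open import Data.List.Relation.Unary.All using (All; []; _∷_)
import Data.List.Relation.Unary.All.Properties as All
open import Data.List.Relation.Unary.Any as Any using (Any; here; there)
import Data.List.Relation.Unary.Any.Properties as Any
open import Data.Nat using (ℕ; zero; suc; _+_; _≤_; _<_; _⊔_; z≤n; s≤s)
open import Data.Nat.Properties
  using (+-suc; ≤-trans; suc-injective; m≤m⊔n; m≤n⊔m; ⊔-lub; _≟_; n≤1+n; ≤∧≢⇒<; m≤m+n; ≤-reflexive;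
         <-irrefl; n≤0⇒n≡0; m≤n⇒m⊓n≡m; ≤-pred)
open import Data.Product using (Σ; _×_; _,_; proj₁; proj₂; map₁)
open import Data.Sum using (_⊎_; inj₁; inj₂)
open import Data.Unit using (⊤; tt)
open import Relation.Binary.PropositionalEquality
open import Relation.Nullary using (¬_; yes; no)

module _ {A : Set} where

  take-++-length : ∀ {n} (xs ys : List A) → length xs ≡ n → take n (xs ++ ys) ≡ xs
  take-++-length []       ys refl = refl
  take-++-length (x ∷ xs) ys refl = cong (x ∷_) (take-++-length xs ys refl)

  drop-++-length : ∀ {n} (xs ys : List A) → length xs ≡ n → drop n (xs ++ ys) ≡ ys
  drop-++-length []       ys refl = refl
  drop-++-length (x ∷ xs) ys refl = drop-++-length xs ys refl

  take-++-≤ : ∀ n (xs ys : List A) → n ≤ length xs → take n (xs ++ ys) ≡ take n xs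
  take-++-≤ zero    xs       ys _       = refl
  take-++-≤ (suc n) (x ∷ xs) ys (s≤s p) = cong (x ∷_) (take-++-≤ n xs ys p)

  drop-++-≤ : ∀ n (xs ys : List A) → n ≤ length xs → drop n (xs ++ ys) ≡ drop n xs ++ ys
  drop-++-≤ zero    xs       ys _       = refl
  drop-++-≤ (suc n) (x ∷ xs) ys (s≤s p) = drop-++-≤ n xs ys p

  length-take-drop : ∀ m n (xs : List A) → length xs ≡ m + n →
                     length (take m xs) ≡ m × length (drop m xs) ≡ n
  length-take-drop zero    n xs       e = refl , e
  length-take-drop (suc m) n (x ∷ xs) e = map₁ (cong suc) (length-take-drop m n xs (suc-injective e))

  ++-injective : ∀ (xs ys xs′ ys′ : List A) → length xs ≡ length xs′ → xs ++ ys ≡ xs′ ++ ys′ →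
                 xs ≡ xs′ × ys ≡ ys′
  ++-injective []       ys []        ys′ _ e = refl , e
  ++-injective (x ∷ xs) ys (x′ ∷ xs′) ys′ l e with ∷-injective e
  ... | refl , e′ = map₁ (cong (x ∷_)) (++-injective xs ys xs′ ys′ (suc-injective l) e′)

  ++-∷-split : ∀ (xs ys zs : List A) {w ws} → xs ++ ys ≡ zs ++ w ∷ ws →
               (Σ (List A) λ zs′ → zs ≡ xs ++ zs′ × ys ≡ zs′ ++ w ∷ ws)
               ⊎ (Σ (List A) λ zs₁ → Σ (List A) λ zs₂ → xs ≡ zs₁ ++ w ∷ zs₂)
  ++-∷-split []       ys zs       e = inj₁ (zs , refl , e)
  ++-∷-split (x ∷ xs) ys []       e with ∷-injective e
  ... | refl , _ = inj₂ ([] , xs , refl)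
  ++-∷-split (x ∷ xs) ys (z ∷ zs) e with ∷-injective e
  ... | refl , e′ with ++-∷-split xs ys zs e′
  ...   | inj₁ (zs′ , p , q)     = inj₁ (zs′ , cong (x ∷_) p , q)
  ...   | inj₂ (zs₁ , zs₂ , p)   = inj₂ (x ∷ zs₁ , zs₂ , cong (x ∷_) p)

  split₃ : ∀ (xs : List A) a b c → length xs ≡ a + (b + c) →
           Σ (List A) λ xs₁ → Σ (List A) λ xsₘ → Σ (List A) λ xs₂ →
           xs ≡ xs₁ ++ xsₘ ++ xs₂ × length xs₁ ≡ a × length xsₘ ≡ b × length xs₂ ≡ c
  split₃ xs a b c e with length-take-drop a (b + c) xs e
  ... | l₁ , l₂ with length-take-drop b c (drop a xs) l₂
  ... | lₘ , l₃ =
    take a xs , take b (drop a xs) , drop b (drop a xs) ,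
    sym (trans (cong (take a xs ++_) (take++drop≡id b (drop a xs))) (take++drop≡id a xs)) , l₁ , lₘ , l₃

module _ (R : SRS) where
  open SRS R

  infix 4 _⊢_⇒_ _≈_
  _⊢_⇒_ : PT R → Str R → Str R → Set
  γ ⊢ s ⇒ t = _∶_⇒_ R γ s t

  _≈_ : PT R → PT R → Set
  _≈_ = _≃_ R

  ⇒-unique : ∀ {γ s t s′ t′} → γ ⊢ s ⇒ t → γ ⊢ s′ ⇒ t′ → s ≡ s′ × t ≡ t′
  ⇒-unique tε        tε        = refl , refl
  ⇒-unique (tlt a)   (tlt .a)  = refl , refl
  ⇒-unique (trl ρ)   (trl .ρ)  = refl , refl
  ⇒-unique (t⊗ d₁ d₂) (t⊗ e₁ e₂) with ⇒-unique d₁ e₁ | ⇒-unique d₂ e₂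
  ... | refl , refl | refl , refl = refl , refl
  ⇒-unique (t⊙ d₁ d₂) (t⊙ e₁ e₂) with ⇒-unique d₁ e₁ | ⇒-unique d₂ e₂
  ... | refl , _ | _ , refl = refl , refl

  retype : ∀ {γ s t s′ t′} → s ≡ s′ → t ≡ t′ → γ ⊢ s ⇒ t → γ ⊢ s′ ⇒ t′
  retype refl refl d = d

  string-source≡target : ∀ {γ s t} → IsString R γ → γ ⊢ s ⇒ t → s ≡ t
  string-source≡target sε        tε         = refl
  string-source≡target (slt a)   (tlt .a)   = refl
  string-source≡target (s⊗ p q)  (t⊗ d₁ d₂) = cong₂ _++_ (string-source≡target p d₁) (string-source≡target q d₂)

  sourceLength : PT R → ℕ
  sourceLength ε       = 0
  sourceLength (lt a)  = 1
  sourceLength (rl ρ)  = length (lhs ρ)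
  sourceLength (γ ⊗ δ) = sourceLength γ + sourceLength δ
  sourceLength (γ ⊙ δ) = sourceLength γ

  sourceLength-⊢ : ∀ {γ s t} → γ ⊢ s ⇒ t → sourceLength γ ≡ length s
  sourceLength-⊢ tε       = refl
  sourceLength-⊢ (tlt a)  = refl
  sourceLength-⊢ (trl ρ)  = refl
  sourceLength-⊢ (t⊗ {s₁ = s₁} d₁ d₂) =
    trans (cong₂ _+_ (sourceLength-⊢ d₁) (sourceLength-⊢ d₂)) (sym (length-++ s₁))
  sourceLength-⊢ (t⊙ d₁ d₂) = sourceLength-⊢ d₁

  split-lengths : ∀ {γ s₁ t₁} s₂ → γ ⊢ s₁ ⇒ t₁ → ∀ {B : Set} (S : List B) → length S ≡ length (s₁ ++ s₂) →
                  length (take (sourceLength γ) S) ≡ length s₁ × length (drop (sourceLength γ) S) ≡ length s₂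
  split-lengths {γ} {s₁} s₂ d S e
    with length-take-drop (sourceLength γ) (length s₂) S
           (trans e (trans (length-++ s₁) (cong (_+ length s₂) (sym (sourceLength-⊢ d)))))
  ... | l₁ , l₂ = trans l₁ (sourceLength-⊢ d) , l₂

  -- A history is a letter occurrence together with the rule application that created it;
  -- the inputs of that application are again histories.
  data History : Set where
    leaf : Letter → History
    node : Rule → Letter → List History → History

  mutual
    level : History → ℕ
    level (leaf a)      = 0
    level (node ρ c hs) = suc (maxLevel hs)

    maxLevel : List History → ℕ
    maxLevel []       = 0
    maxLevel (h ∷ hs) = level h ⊔ maxLevel hs

  letterOf : History → Letter
  letterOf (leaf a)      = a
  letterOf (node ρ c hs) = c

  outputs : Rule → List History → List History
  outputs ρ W = map (λ c → node ρ c W) (rhs ρ)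

  run : PT R → List History → List History
  run ε       S = []
  run (lt a)  S = S
  run (rl ρ)  S = outputs ρ S
  run (γ ⊗ δ) S = run γ (take (sourceLength γ) S) ++ run δ (drop (sourceLength γ) S)
  run (γ ⊙ δ) S = run δ (run γ S)

  run-length : ∀ {γ s t} → γ ⊢ s ⇒ t → ∀ S → length S ≡ length s → length (run γ S) ≡ length t
  run-length tε      S e = refl
  run-length (tlt a) S e = e
  run-length (trl ρ) S e = length-map _ (rhs ρ)
  run-length (t⊗ {γ} {t₁ = t₁} {t₂} d₁ d₂) S e =
    let l₁ , l₂ = split-lengths _ d₁ S e in
    trans (length-++ (run γ (take (sourceLength γ) S)))
          (trans (cong₂ _+_ (run-length d₁ _ l₁) (run-length d₂ _ l₂)) (sym (length-++ t₁)))
  run-length (t⊙ d₁ d₂) S e = run-length d₂ _ (run-length d₁ S e)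

  run-string : ∀ {γ s t} → IsString R γ → γ ⊢ s ⇒ t → ∀ S → length S ≡ length s → run γ S ≡ S
  run-string sε      tε       [] e = refl
  run-string (slt a) (tlt .a) S  e = refl
  run-string (s⊗ p q) (t⊗ {γ} d₁ d₂) S e =
    let l₁ , l₂ = split-lengths _ d₁ S e in
    trans (cong₂ _++_ (run-string p d₁ _ l₁) (run-string q d₂ _ l₂)) (take++drop≡id (sourceLength γ) S)

  ⊗-inversion : ∀ {γ δ s t} → (γ ⊗ δ) ⊢ s ⇒ t →
                Σ (Str R) λ s₁ → Σ (Str R) λ s₂ → Σ (Str R) λ t₁ → Σ (Str R) λ t₂ →
                γ ⊢ s₁ ⇒ t₁ × δ ⊢ s₂ ⇒ t₂ × s ≡ s₁ ++ s₂ × t ≡ t₁ ++ t₂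
  ⊗-inversion (t⊗ d₁ d₂) = _ , _ , _ , _ , d₁ , d₂ , refl , refl

  axiom-preserves-run : ∀ {γ δ s t s′ t′} → Axiom R γ δ → γ ⊢ s ⇒ t → δ ⊢ s′ ⇒ t′ →
                        s ≡ s′ × t ≡ t′ × (∀ S → length S ≡ length s → run γ S ≡ run δ S)
  axiom-preserves-run (unitˡ γ) (t⊗ tε d) d′ with ⇒-unique d d′
  ... | refl , refl = refl , refl , λ S e → refl
  axiom-preserves-run (unitʳ γ) (t⊗ {s₁ = s₁} {t₁ = t₁} d tε) d′ with ⇒-unique d d′
  ... | refl , refl = ++-identityʳ s₁ , ++-identityʳ t₁ , λ S e →
    trans (++-identityʳ _)
          (cong (run γ) (take-all _ S (≤-reflexive (trans e (trans (cong length (++-identityʳ s₁))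
                                                                  (sym (sourceLength-⊢ d)))))))
  axiom-preserves-run (assoc⊗ γ δ ζ) (t⊗ {s₂ = s₃} {t₂ = t₃} (t⊗ {s₁ = s₁} {s₂} {t₁} {t₂} dγ dδ) dζ)
                      (t⊗ eγ (t⊗ eδ eζ))
    with ⇒-unique dγ eγ | ⇒-unique dδ eδ | ⇒-unique dζ eζ
  ... | refl , refl | refl , refl | refl , refl = ++-assoc s₁ s₂ s₃ , ++-assoc t₁ t₂ t₃ , λ S e →
    let a = sourceLength γ ; b = sourceLength δ in
    begin
      (run γ (take a (take (a + b) S)) ++ run δ (drop a (take (a + b) S))) ++ run ζ (drop (a + b) S)
    ≡⟨ cong₂ (λ X Y → (run γ X ++ run δ Y) ++ run ζ (drop (a + b) S))
             (trans (take-take a (a + b) S) (cong (λ n → take n S) (m≤n⇒m⊓n≡m (m≤m+n a b))))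
             (sym (take-drop b a S)) ⟩
      (run γ (take a S) ++ run δ (take b (drop a S))) ++ run ζ (drop (a + b) S)
    ≡⟨ cong (λ X → (run γ (take a S) ++ run δ (take b (drop a S))) ++ run ζ X) (sym (drop-drop a b S)) ⟩
      (run γ (take a S) ++ run δ (take b (drop a S))) ++ run ζ (drop b (drop a S))
    ≡⟨ ++-assoc (run γ (take a S)) _ _ ⟩
      run γ (take a S) ++ run δ (take b (drop a S)) ++ run ζ (drop b (drop a S))
    ∎
    where open ≡-Reasoning
  axiom-preserves-run (idˡ σ γ p) (t⊙ d₁ d₂) d′ with string-source≡target p d₁
  ... | refl with ⇒-unique d₂ d′
  ... | refl , refl = refl , refl , λ S e → cong (run γ) (run-string p d₁ S e)
  axiom-preserves-run (idʳ γ σ p) (t⊙ d₁ d₂) d′ with string-source≡target p d₂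
  ... | refl with ⇒-unique d₁ d′
  ... | refl , refl = refl , refl , λ S e → run-string p d₂ (run γ S) (run-length d₁ S e)
  axiom-preserves-run (assoc⊙ γ δ ζ) (t⊙ (t⊙ dγ dδ) dζ) (t⊙ eγ (t⊙ eδ eζ))
    with ⇒-unique dγ eγ | ⇒-unique dζ eζ
  ... | refl , _ | _ , refl = refl , refl , λ S e → refl
  axiom-preserves-run (exch γ δ ζ η) (t⊙ (t⊗ {s₂ = s₂} dγ dδ) dζη) (t⊗ (t⊙ eγ eζ) (t⊙ eδ eη))
    with ⊗-inversion dζη
  ... | _ , _ , _ , _ , dζ , dη , _ , refl
    with ⇒-unique dγ eγ | ⇒-unique dδ eδ | ⇒-unique dζ eζ | ⇒-unique dη eη
  ... | refl , refl | refl , refl | refl , refl | refl , refl = refl , refl , λ S e →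
    let X₁ = run γ (take (sourceLength γ) S)
        X₂ = run δ (drop (sourceLength γ) S)
        l = trans (run-length dγ _ (proj₁ (split-lengths s₂ dγ S e))) (sym (sourceLength-⊢ dζ))
    in cong₂ (λ A B → run ζ A ++ run η B) (take-++-length X₁ X₂ l) (drop-++-length X₁ X₂ l)

  record RunEquivalent (γ δ : PT R) : Set where
    field
      {source target} : Str R
      ⊢γ : γ ⊢ source ⇒ target
      ⊢δ : δ ⊢ source ⇒ target
      same-run : ∀ S → length S ≡ length source → run γ S ≡ run δ S

  ≈⇒RunEquivalent : ∀ {γ δ} → γ ≈ δ → RunEquivalent γ δ
  ≈⇒RunEquivalent (ax a (_ , _ , d) (_ , _ , d′)) with axiom-preserves-run a d d′
  ... | refl , refl , f = record { ⊢γ = d ; ⊢δ = d′ ; same-run = f }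
  ≈⇒RunEquivalent (≃refl (_ , _ , d)) = record { ⊢γ = d ; ⊢δ = d ; same-run = λ S e → refl }
  ≈⇒RunEquivalent (≃sym p) =
    let open RunEquivalent (≈⇒RunEquivalent p) in
    record { ⊢γ = ⊢δ ; ⊢δ = ⊢γ ; same-run = λ S e → sym (same-run S e) }
  ≈⇒RunEquivalent (≃trans p q) with ≈⇒RunEquivalent p | ≈⇒RunEquivalent q
  ... | record { ⊢γ = d ; ⊢δ = d′ ; same-run = f } | record { ⊢γ = e ; ⊢δ = e′ ; same-run = g }
    with ⇒-unique d′ e
  ... | refl , refl = record { ⊢γ = d ; ⊢δ = e′ ; same-run = λ S l → trans (f S l) (g S l) }
  ≈⇒RunEquivalent (cong⊗ {γ' = γ′} {δ' = δ′} p q) with ≈⇒RunEquivalent p | ≈⇒RunEquivalent q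
  ... | record { ⊢γ = d₁ ; ⊢δ = d₁′ ; same-run = f } | record { ⊢γ = d₂ ; ⊢δ = d₂′ ; same-run = g } =
    record { ⊢γ = t⊗ d₁ d₂ ; ⊢δ = t⊗ d₁′ d₂′ ; same-run = λ S e →
      let l₁ , l₂ = split-lengths _ d₁ S e in
      trans (cong₂ _++_ (f _ l₁) (g _ l₂))
            (cong (λ n → run γ′ (take n S) ++ run δ′ (drop n S))
                  (trans (sourceLength-⊢ d₁) (sym (sourceLength-⊢ d₁′)))) }
  ≈⇒RunEquivalent (cong⊙ {δ' = δ′} p q (_ , _ , t⊙ e₁ e₂) _) with ≈⇒RunEquivalent p | ≈⇒RunEquivalent q
  ... | record { ⊢γ = d₁ ; ⊢δ = d₁′ ; same-run = f } | record { ⊢γ = d₂ ; ⊢δ = d₂′ ; same-run = g }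
    with ⇒-unique d₁ e₁ | ⇒-unique d₂ e₂
  ... | refl , refl | refl , refl =
    record { ⊢γ = t⊙ d₁ d₂ ; ⊢δ = t⊙ d₁′ d₂′ ;
             same-run = λ S e → trans (g _ (run-length d₁ S e)) (cong (run δ′) (f S e)) }

  ≈-run : ∀ {γ δ s t} → γ ≈ δ → γ ⊢ s ⇒ t → ∀ S → length S ≡ length s → run γ S ≡ run δ S
  ≈-run p d with ≈⇒RunEquivalent p
  ... | record { ⊢γ = d₁ ; same-run = f } with ⇒-unique d d₁
  ... | refl , refl = f

  ≈-⊢ : ∀ {γ δ s t} → γ ≈ δ → γ ⊢ s ⇒ t → δ ⊢ s ⇒ t
  ≈-⊢ p d with ≈⇒RunEquivalent p
  ... | record { ⊢γ = d₁ ; ⊢δ = d₂ } with ⇒-unique d d₁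
  ... | refl , refl = d₂

  typed : ∀ {γ s t} → γ ⊢ s ⇒ t → IsProofTerm R γ
  typed d = _ , _ , d

  infixr 5 _∙_
  _∙_ : ∀ {γ δ ζ} → γ ≈ δ → δ ≈ ζ → γ ≈ ζ
  _∙_ = ≃trans

  ≈-refl : ∀ {γ s t} → γ ⊢ s ⇒ t → γ ≈ γ
  ≈-refl d = ≃refl (typed d)

  ≈-cong⊙ : ∀ {γ γ′ δ δ′ s t u} → γ ≈ γ′ → δ ≈ δ′ → γ ⊢ s ⇒ t → δ ⊢ t ⇒ u → (γ ⊙ δ) ≈ (γ′ ⊙ δ′)
  ≈-cong⊙ p q d₁ d₂ = cong⊙ p q (typed (t⊙ d₁ d₂)) (typed (t⊙ (≈-⊢ p d₁) (≈-⊢ q d₂)))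

  unitˡ-≈ : ∀ {γ s t} → γ ⊢ s ⇒ t → (ε ⊗ γ) ≈ γ
  unitˡ-≈ d = ax (unitˡ _) (typed (t⊗ tε d)) (typed d)

  unitʳ-≈ : ∀ {γ s t} → γ ⊢ s ⇒ t → (γ ⊗ ε) ≈ γ
  unitʳ-≈ d = ax (unitʳ _) (typed (t⊗ d tε)) (typed d)

  assoc⊗-≈ : ∀ {γ δ ζ s₁ t₁ s₂ t₂ s₃ t₃} → γ ⊢ s₁ ⇒ t₁ → δ ⊢ s₂ ⇒ t₂ → ζ ⊢ s₃ ⇒ t₃ →
             ((γ ⊗ δ) ⊗ ζ) ≈ (γ ⊗ (δ ⊗ ζ))
  assoc⊗-≈ d₁ d₂ d₃ = ax (assoc⊗ _ _ _) (typed (t⊗ (t⊗ d₁ d₂) d₃)) (typed (t⊗ d₁ (t⊗ d₂ d₃)))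

  assoc⊙-≈ : ∀ {γ δ ζ s t u v} → γ ⊢ s ⇒ t → δ ⊢ t ⇒ u → ζ ⊢ u ⇒ v → ((γ ⊙ δ) ⊙ ζ) ≈ (γ ⊙ (δ ⊙ ζ))
  assoc⊙-≈ d₁ d₂ d₃ = ax (assoc⊙ _ _ _) (typed (t⊙ (t⊙ d₁ d₂) d₃)) (typed (t⊙ d₁ (t⊙ d₂ d₃)))

  idˡ-≈ : ∀ {σ γ s t} → IsString R σ → σ ⊢ s ⇒ s → γ ⊢ s ⇒ t → (σ ⊙ γ) ≈ γ
  idˡ-≈ p d₁ d₂ = ax (idˡ _ _ p) (typed (t⊙ d₁ d₂)) (typed d₂)

  idʳ-≈ : ∀ {σ γ s t} → γ ⊢ s ⇒ t → IsString R σ → σ ⊢ t ⇒ t → (γ ⊙ σ) ≈ γ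
  idʳ-≈ d₂ p d₁ = ax (idʳ _ _ p) (typed (t⊙ d₂ d₁)) (typed d₂)

  exch-≈ : ∀ {γ δ ζ η s₁ t₁ s₂ t₂ u₁ u₂} → γ ⊢ s₁ ⇒ t₁ → δ ⊢ s₂ ⇒ t₂ → ζ ⊢ t₁ ⇒ u₁ → η ⊢ t₂ ⇒ u₂ →
           ((γ ⊗ δ) ⊙ (ζ ⊗ η)) ≈ ((γ ⊙ ζ) ⊗ (δ ⊙ η))
  exch-≈ d₁ d₂ d₃ d₄ = ax (exch _ _ _ _) (typed (t⊙ (t⊗ d₁ d₂) (t⊗ d₃ d₄))) (typed (t⊗ (t⊙ d₁ d₃) (t⊙ d₂ d₄)))

  -- Multisteps

  Multistep : Set
  Multistep = MS R

  srcₘ tgtₘ : Multistep → Str R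
  srcₘ = src R
  tgtₘ = tgt R

  embₘ : Multistep → PT R
  embₘ = embMS R

  idₘ : Str R → Multistep
  idₘ = letters R

  #ρ : Multistep → ℕ
  #ρ = #rules R

  srcₘ-idₘ : ∀ u → srcₘ (idₘ u) ≡ u
  srcₘ-idₘ []      = refl
  srcₘ-idₘ (a ∷ u) = cong (a ∷_) (srcₘ-idₘ u)

  tgtₘ-idₘ : ∀ u → tgtₘ (idₘ u) ≡ u
  tgtₘ-idₘ []      = refl
  tgtₘ-idₘ (a ∷ u) = cong (a ∷_) (tgtₘ-idₘ u)

  idₘ-++ : ∀ u v → idₘ (u ++ v) ≡ idₘ u ++ idₘ v
  idₘ-++ = map-++ inj₁

  srcₘ-++ : ∀ Φ Ψ → srcₘ (Φ ++ Ψ) ≡ srcₘ Φ ++ srcₘ Ψ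
  srcₘ-++ []            Ψ = refl
  srcₘ-++ (inj₁ a ∷ Φ) Ψ = cong (a ∷_) (srcₘ-++ Φ Ψ)
  srcₘ-++ (inj₂ ρ ∷ Φ) Ψ = trans (cong (lhs ρ ++_) (srcₘ-++ Φ Ψ)) (sym (++-assoc (lhs ρ) _ _))

  tgtₘ-++ : ∀ Φ Ψ → tgtₘ (Φ ++ Ψ) ≡ tgtₘ Φ ++ tgtₘ Ψ
  tgtₘ-++ []            Ψ = refl
  tgtₘ-++ (inj₁ a ∷ Φ) Ψ = cong (a ∷_) (tgtₘ-++ Φ Ψ)
  tgtₘ-++ (inj₂ ρ ∷ Φ) Ψ = trans (cong (rhs ρ ++_) (tgtₘ-++ Φ Ψ)) (sym (++-assoc (rhs ρ) _ _))

  srcₘ-gap : ∀ Φ₁ u Φ₂ → srcₘ (Φ₁ ++ idₘ u ++ Φ₂) ≡ srcₘ Φ₁ ++ u ++ srcₘ Φ₂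
  srcₘ-gap Φ₁ u Φ₂ =
    trans (srcₘ-++ Φ₁ _) (cong (srcₘ Φ₁ ++_) (trans (srcₘ-++ (idₘ u) Φ₂) (cong (_++ srcₘ Φ₂) (srcₘ-idₘ u))))

  tgtₘ-gap : ∀ Φ₁ u Φ₂ → tgtₘ (Φ₁ ++ idₘ u ++ Φ₂) ≡ tgtₘ Φ₁ ++ u ++ tgtₘ Φ₂
  tgtₘ-gap Φ₁ u Φ₂ =
    trans (tgtₘ-++ Φ₁ _) (cong (tgtₘ Φ₁ ++_) (trans (tgtₘ-++ (idₘ u) Φ₂) (cong (_++ tgtₘ Φ₂) (tgtₘ-idₘ u))))

  length-srcₘ-gap : ∀ Φ₁ u Φ₂ →
                    length (srcₘ (Φ₁ ++ idₘ u ++ Φ₂)) ≡ length (srcₘ Φ₁) + (length u + length (srcₘ Φ₂))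
  length-srcₘ-gap Φ₁ u Φ₂ =
    trans (cong length (srcₘ-gap Φ₁ u Φ₂)) (trans (length-++ (srcₘ Φ₁)) (cong (length (srcₘ Φ₁) +_) (length-++ u)))

  #ρ-++ : ∀ Φ Ψ → #ρ (Φ ++ Ψ) ≡ #ρ Φ + #ρ Ψ
  #ρ-++ []            Ψ = refl
  #ρ-++ (inj₁ a ∷ Φ) Ψ = #ρ-++ Φ Ψ
  #ρ-++ (inj₂ ρ ∷ Φ) Ψ = cong suc (#ρ-++ Φ Ψ)

  #ρ-idₘ : ∀ u → #ρ (idₘ u) ≡ 0
  #ρ-idₘ []      = refl
  #ρ-idₘ (a ∷ u) = #ρ-idₘ u

  #ρ-idₘ-++ : ∀ u Φ → #ρ (idₘ u ++ Φ) ≡ #ρ Φ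
  #ρ-idₘ-++ []      Φ = refl
  #ρ-idₘ-++ (a ∷ u) Φ = #ρ-idₘ-++ u Φ

  #ρ-gap : ∀ Φ₁ u Φ₂ → #ρ (Φ₁ ++ idₘ u ++ Φ₂) ≡ #ρ Φ₁ + #ρ Φ₂
  #ρ-gap Φ₁ u Φ₂ = trans (#ρ-++ Φ₁ _) (cong (#ρ Φ₁ +_) (#ρ-idₘ-++ u Φ₂))

  embₘ-⊢ : ∀ Φ → embₘ Φ ⊢ srcₘ Φ ⇒ tgtₘ Φ
  embₘ-⊢ []            = tε
  embₘ-⊢ (inj₁ a ∷ Φ) = t⊗ (tlt a) (embₘ-⊢ Φ)
  embₘ-⊢ (inj₂ ρ ∷ Φ) = t⊗ (trl ρ) (embₘ-⊢ Φ)

  idₘ-⊢ : ∀ u → embₘ (idₘ u) ⊢ u ⇒ u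
  idₘ-⊢ u = retype (srcₘ-idₘ u) (tgtₘ-idₘ u) (embₘ-⊢ (idₘ u))

  idₘ-string : ∀ u → IsString R (embₘ (idₘ u))
  idₘ-string []      = sε
  idₘ-string (a ∷ u) = s⊗ (slt a) (idₘ-string u)

  runₘ : Multistep → List History → List History
  runₘ Φ = run (embₘ Φ)

  runₘ-idₘ : ∀ u S → length S ≡ length u → runₘ (idₘ u) S ≡ S
  runₘ-idₘ u = run-string (idₘ-string u) (idₘ-⊢ u)

  runₘ-length : ∀ Φ S → length S ≡ length (srcₘ Φ) → length (runₘ Φ S) ≡ length (tgtₘ Φ)
  runₘ-length Φ = run-length (embₘ-⊢ Φ)

  runₘ-++ : ∀ Φ Ψ S T → length S ≡ length (srcₘ Φ) → runₘ (Φ ++ Ψ) (S ++ T) ≡ runₘ Φ S ++ runₘ Ψ T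
  runₘ-++ []            Ψ []      T e = refl
  runₘ-++ (inj₁ a ∷ Φ) Ψ (h ∷ S) T e = cong (h ∷_) (runₘ-++ Φ Ψ S T (suc-injective e))
  runₘ-++ (inj₂ ρ ∷ Φ) Ψ S       T e =
    let l = length (lhs ρ)
        e′ = trans e (length-++ (lhs ρ))
        l≤ = subst (l ≤_) (sym e′) (m≤m+n l _)
    in begin
      outputs ρ (take l (S ++ T)) ++ runₘ (Φ ++ Ψ) (drop l (S ++ T))
    ≡⟨ cong₂ (λ X Y → outputs ρ X ++ runₘ (Φ ++ Ψ) Y) (take-++-≤ l S T l≤) (drop-++-≤ l S T l≤) ⟩
      outputs ρ (take l S) ++ runₘ (Φ ++ Ψ) (drop l S ++ T)
    ≡⟨ cong (outputs ρ (take l S) ++_) (runₘ-++ Φ Ψ (drop l S) T (proj₂ (length-take-drop l _ S e′))) ⟩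
      outputs ρ (take l S) ++ runₘ Φ (drop l S) ++ runₘ Ψ T
    ≡⟨ sym (++-assoc (outputs ρ (take l S)) _ _) ⟩
      (outputs ρ (take l S) ++ runₘ Φ (drop l S)) ++ runₘ Ψ T
    ∎
    where open ≡-Reasoning

  runₘ-gap : ∀ Φ₁ u Φ₂ S₁ Sₘ S₂ → length S₁ ≡ length (srcₘ Φ₁) → length Sₘ ≡ length u →
             runₘ (Φ₁ ++ idₘ u ++ Φ₂) (S₁ ++ Sₘ ++ S₂) ≡ runₘ Φ₁ S₁ ++ Sₘ ++ runₘ Φ₂ S₂
  runₘ-gap Φ₁ u Φ₂ S₁ Sₘ S₂ l₁ lₘ =
    trans (runₘ-++ Φ₁ _ S₁ _ l₁)
          (cong (runₘ Φ₁ S₁ ++_)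
                (trans (runₘ-++ (idₘ u) Φ₂ Sₘ S₂ (trans lₘ (sym (cong length (srcₘ-idₘ u)))))
                       (cong (_++ runₘ Φ₂ S₂) (runₘ-idₘ u Sₘ lₘ))))

  idₘ-unitˡ : ∀ {γ s t} → γ ⊢ s ⇒ t → (embₘ (idₘ s) ⊙ γ) ≈ γ
  idₘ-unitˡ {s = s} = idˡ-≈ (idₘ-string s) (idₘ-⊢ s)

  idₘ-unitʳ : ∀ {γ s t} → γ ⊢ s ⇒ t → (γ ⊙ embₘ (idₘ t)) ≈ γ
  idₘ-unitʳ {t = t} d = idʳ-≈ d (idₘ-string t) (idₘ-⊢ t)

  ≡⇒≈ : ∀ {Φ Ψ} → Φ ≡ Ψ → embₘ Φ ≈ embₘ Ψ
  ≡⇒≈ {Φ} refl = ≈-refl (embₘ-⊢ Φ)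

  embₘ-++ : ∀ Φ Ψ → embₘ (Φ ++ Ψ) ≈ (embₘ Φ ⊗ embₘ Ψ)
  embₘ-++ []            Ψ = ≃sym (unitˡ-≈ (embₘ-⊢ Ψ))
  embₘ-++ (inj₁ a ∷ Φ) Ψ = cong⊗ (≈-refl (tlt a)) (embₘ-++ Φ Ψ) ∙ ≃sym (assoc⊗-≈ (tlt a) (embₘ-⊢ Φ) (embₘ-⊢ Ψ))
  embₘ-++ (inj₂ ρ ∷ Φ) Ψ = cong⊗ (≈-refl (trl ρ)) (embₘ-++ Φ Ψ) ∙ ≃sym (assoc⊗-≈ (trl ρ) (embₘ-⊢ Φ) (embₘ-⊢ Ψ))

  ⊙-++ : ∀ A₁ A₂ B₁ B₂ C₁ C₂ → tgtₘ A₁ ≡ srcₘ B₁ → tgtₘ A₂ ≡ srcₘ B₂ →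
         (embₘ A₁ ⊙ embₘ B₁) ≈ embₘ C₁ → (embₘ A₂ ⊙ embₘ B₂) ≈ embₘ C₂ →
         (embₘ (A₁ ++ A₂) ⊙ embₘ (B₁ ++ B₂)) ≈ embₘ (C₁ ++ C₂)
  ⊙-++ A₁ A₂ B₁ B₂ C₁ C₂ e₁ e₂ p q =
    ≈-cong⊙ (embₘ-++ A₁ A₂) (embₘ-++ B₁ B₂) (embₘ-⊢ (A₁ ++ A₂))
            (retype (trans (srcₘ-++ B₁ B₂) (sym (trans (tgtₘ-++ A₁ A₂) (cong₂ _++_ e₁ e₂)))) refl (embₘ-⊢ (B₁ ++ B₂)))
    ∙ exch-≈ (embₘ-⊢ A₁) (embₘ-⊢ A₂) (retype (sym e₁) refl (embₘ-⊢ B₁)) (retype (sym e₂) refl (embₘ-⊢ B₂))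
    ∙ cong⊗ p q
    ∙ ≃sym (embₘ-++ C₁ C₂)

  ⊙-idₘ : ∀ Φ → (embₘ Φ ⊙ embₘ (idₘ (tgtₘ Φ))) ≈ embₘ Φ
  ⊙-idₘ Φ = idₘ-unitʳ (embₘ-⊢ Φ)

  idₘ-⊙ : ∀ Φ → (embₘ (idₘ (srcₘ Φ)) ⊙ embₘ Φ) ≈ embₘ Φ
  idₘ-⊙ Φ = idₘ-unitˡ (embₘ-⊢ Φ)

  rule-⊢ : ∀ σ → embₘ (inj₂ σ ∷ []) ⊢ lhs σ ⇒ rhs σ
  rule-⊢ σ = retype (++-identityʳ _) (++-identityʳ _) (embₘ-⊢ (inj₂ σ ∷ []))

  Step : Set
  Step = Str R × Rule × Str R

  stepₘ : Step → Multistep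
  stepₘ (a , σ , b) = idₘ a ++ inj₂ σ ∷ idₘ b

  srcₛ tgtₛ : Step → Str R
  srcₛ (a , σ , b) = a ++ lhs σ ++ b
  tgtₛ (a , σ , b) = a ++ rhs σ ++ b

  absorb-step : ∀ Φ₁ σ Φ₂ →
    (embₘ (Φ₁ ++ idₘ (lhs σ) ++ Φ₂) ⊙ embₘ (stepₘ (tgtₘ Φ₁ , σ , tgtₘ Φ₂))) ≈ embₘ (Φ₁ ++ inj₂ σ ∷ Φ₂)
  absorb-step Φ₁ σ Φ₂ =
    ⊙-++ Φ₁ _ (idₘ (tgtₘ Φ₁)) _ Φ₁ _ (sym (srcₘ-idₘ _))
         (trans (tgtₘ-++ (idₘ (lhs σ)) Φ₂) (cong₂ _++_ (tgtₘ-idₘ (lhs σ)) (sym (srcₘ-idₘ (tgtₘ Φ₂)))))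
         (⊙-idₘ Φ₁)
         (⊙-++ (idₘ (lhs σ)) Φ₂ (inj₂ σ ∷ []) (idₘ (tgtₘ Φ₂)) (inj₂ σ ∷ []) Φ₂
               (trans (tgtₘ-idₘ _) (sym (++-identityʳ _))) (sym (srcₘ-idₘ _))
               (idₘ-unitˡ (rule-⊢ σ)) (⊙-idₘ Φ₂))

  extract-step : ∀ Φ₁ σ Φ₂ →
    (embₘ (stepₘ (srcₘ Φ₁ , σ , srcₘ Φ₂)) ⊙ embₘ (Φ₁ ++ idₘ (rhs σ) ++ Φ₂)) ≈ embₘ (Φ₁ ++ inj₂ σ ∷ Φ₂)
  extract-step Φ₁ σ Φ₂ =
    ⊙-++ (idₘ (srcₘ Φ₁)) _ Φ₁ _ Φ₁ _ (tgtₘ-idₘ _)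
         (trans (cong (rhs σ ++_) (tgtₘ-idₘ _))
                (sym (trans (srcₘ-++ (idₘ (rhs σ)) Φ₂) (cong (_++ srcₘ Φ₂) (srcₘ-idₘ _)))))
         (idₘ-⊙ Φ₁)
         (⊙-++ (inj₂ σ ∷ []) (idₘ (srcₘ Φ₂)) (idₘ (rhs σ)) Φ₂ (inj₂ σ ∷ []) Φ₂
               (trans (++-identityʳ _) (sym (srcₘ-idₘ _))) (tgtₘ-idₘ _)
               (idₘ-unitʳ (rule-⊢ σ)) (idₘ-⊙ Φ₂))

  -- Levels

  AtMost : ℕ → List History → Set
  AtMost K = All (λ h → level h ≤ K)

  maxLevel≤ : ∀ {K} S → AtMost K S → maxLevel S ≤ K
  maxLevel≤ []      []       = z≤n
  maxLevel≤ (h ∷ S) (p ∷ ps) = ⊔-lub p (maxLevel≤ S ps)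

  maxLevel≤⇒AtMost : ∀ {K} S → maxLevel S ≤ K → AtMost K S
  maxLevel≤⇒AtMost []      p = []
  maxLevel≤⇒AtMost (h ∷ S) p =
    ≤-trans (m≤m⊔n (level h) (maxLevel S)) p ∷ maxLevel≤⇒AtMost S (≤-trans (m≤n⊔m (level h) (maxLevel S)) p)

  level-outputs : ∀ ρ W {T₁ h T} → outputs ρ W ≡ T₁ ++ h ∷ T → level h ≡ suc (maxLevel W)
  level-outputs ρ W e = go (rhs ρ) _ e
    where
      go : ∀ cs T₁ {h T} → map (λ c → node ρ c W) cs ≡ T₁ ++ h ∷ T → level h ≡ suc (maxLevel W)
      go (c ∷ cs) []       refl = refl
      go (c ∷ cs) (_ ∷ T₁) e    = go cs T₁ (proj₂ (∷-injective e))

  outputs-AtMost : ∀ {K} ρ W → maxLevel W ≡ K → AtMost (suc K) (outputs ρ W)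
  outputs-AtMost ρ W refl = All.map⁺ (go (rhs ρ))
    where
      go : ∀ cs → All (λ c → level (node ρ c W) ≤ suc (maxLevel W)) cs
      go []       = []
      go (c ∷ cs) = ≤-reflexive refl ∷ go cs

  length-lhs≢0 : ∀ σ → length (lhs σ) ≢ 0
  length-lhs≢0 σ with lhs σ | lhs-nonempty σ
  ... | []    | ne = ⊥-elim (ne refl)
  ... | _ ∷ _ | _  = λ ()

  outputs-++≢[] : ∀ ρ W X → outputs ρ W ++ X ≢ []
  outputs-++≢[] ρ W X = go (rhs ρ) (rhs-nonempty ρ)
    where
      go : ∀ cs → cs ≢ [] → map (λ c → node ρ c W) cs ++ X ≢ []
      go []      ne = ⊥-elim (ne refl)
      go (_ ∷ _) _  = λ ()

  level-head-outputs : ∀ ρ W X {h T} → outputs ρ W ++ X ≡ h ∷ T → level h ≡ suc (maxLevel W)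
  level-head-outputs ρ W X e with ++-∷-split (outputs ρ W) X [] e
  ... | inj₁ (_ , e₀ , _) = ⊥-elim (outputs-++≢[] ρ W _ (sym e₀))
  ... | inj₂ (_ , _ , e′) = level-outputs ρ W e′

  too-high : ∀ {K h} → level h ≡ suc K → ¬ level h ≤ K
  too-high {K} e p = <-irrefl refl (subst (_≤ K) e p)

  Exact : ℕ → Multistep → List History → Set
  Exact K []            S = ⊤
  Exact K (inj₁ a ∷ Φ) S = Exact K Φ (drop 1 S)
  Exact K (inj₂ ρ ∷ Φ) S = maxLevel (take (length (lhs ρ)) S) ≡ K × Exact K Φ (drop (length (lhs ρ)) S)

  Exact-idₘ : ∀ K u S → Exact K (idₘ u) S
  Exact-idₘ K []      S = tt
  Exact-idₘ K (a ∷ u) S = Exact-idₘ K u (drop 1 S)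

  Exact-++⁻ : ∀ K Φ Ψ S T → length S ≡ length (srcₘ Φ) → Exact K (Φ ++ Ψ) (S ++ T) → Exact K Φ S × Exact K Ψ T
  Exact-++⁻ K []            Ψ []      T e x = tt , x
  Exact-++⁻ K (inj₁ a ∷ Φ) Ψ (h ∷ S) T e x = Exact-++⁻ K Φ Ψ S T (suc-injective e) x
  Exact-++⁻ K (inj₂ ρ ∷ Φ) Ψ S       T e (m , x) =
    let l = length (lhs ρ)
        e′ = trans e (length-++ (lhs ρ))
        l≤ = subst (l ≤_) (sym e′) (m≤m+n l _)
        xΦ , xΨ = Exact-++⁻ K Φ Ψ (drop l S) T (proj₂ (length-take-drop l _ S e′))
                            (subst (Exact K (Φ ++ Ψ)) (drop-++-≤ l S T l≤) x)
    in (trans (cong maxLevel (sym (take-++-≤ l S T l≤))) m , xΦ) , xΨ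

  Exact-++⁺ : ∀ K Φ Ψ S T → length S ≡ length (srcₘ Φ) → Exact K Φ S → Exact K Ψ T → Exact K (Φ ++ Ψ) (S ++ T)
  Exact-++⁺ K []            Ψ []      T e _ y = y
  Exact-++⁺ K (inj₁ a ∷ Φ) Ψ (h ∷ S) T e x y = Exact-++⁺ K Φ Ψ S T (suc-injective e) x y
  Exact-++⁺ K (inj₂ ρ ∷ Φ) Ψ S       T e (m , x) y =
    let l = length (lhs ρ)
        e′ = trans e (length-++ (lhs ρ))
        l≤ = subst (l ≤_) (sym e′) (m≤m+n l _)
    in trans (cong maxLevel (take-++-≤ l S T l≤)) m ,
       subst (Exact K (Φ ++ Ψ)) (sym (drop-++-≤ l S T l≤))
             (Exact-++⁺ K Φ Ψ (drop l S) T (proj₂ (length-take-drop l _ S e′)) x y)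

  Exact-gap⁻ : ∀ K Φ₁ u Φ₂ S₁ Sₘ S₂ → length S₁ ≡ length (srcₘ Φ₁) → length Sₘ ≡ length u →
               Exact K (Φ₁ ++ idₘ u ++ Φ₂) (S₁ ++ Sₘ ++ S₂) → Exact K Φ₁ S₁ × Exact K Φ₂ S₂
  Exact-gap⁻ K Φ₁ u Φ₂ S₁ Sₘ S₂ l₁ lₘ x =
    let x₁ , x′ = Exact-++⁻ K Φ₁ _ S₁ _ l₁ x in
    x₁ , proj₂ (Exact-++⁻ K (idₘ u) Φ₂ Sₘ S₂ (trans lₘ (sym (cong length (srcₘ-idₘ u)))) x′)

  Exact-gap⁺ : ∀ K Φ₁ u Φ₂ S₁ Sₘ S₂ → length S₁ ≡ length (srcₘ Φ₁) → length Sₘ ≡ length u →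
               Exact K Φ₁ S₁ → Exact K Φ₂ S₂ → Exact K (Φ₁ ++ idₘ u ++ Φ₂) (S₁ ++ Sₘ ++ S₂)
  Exact-gap⁺ K Φ₁ u Φ₂ S₁ Sₘ S₂ l₁ lₘ x₁ x₂ =
    Exact-++⁺ K Φ₁ _ S₁ _ l₁ x₁
              (Exact-++⁺ K (idₘ u) Φ₂ Sₘ S₂ (trans lₘ (sym (cong length (srcₘ-idₘ u)))) (Exact-idₘ K u Sₘ) x₂)

  Exact-zero : ∀ Φ S → AtMost 0 S → Exact 0 Φ S
  Exact-zero []            S al = tt
  Exact-zero (inj₁ a ∷ Φ) S al = Exact-zero Φ (drop 1 S) (All.drop⁺ 1 al)
  Exact-zero (inj₂ ρ ∷ Φ) S al =
    n≤0⇒n≡0 (maxLevel≤ _ (All.take⁺ (length (lhs ρ)) al)) ,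
    Exact-zero Φ (drop (length (lhs ρ)) S) (All.drop⁺ (length (lhs ρ)) al)

  Spells : List History → Str R → Set
  Spells S u = map letterOf S ≡ u

  Spells-length : ∀ S {u} → Spells S u → length S ≡ length u
  Spells-length S e = trans (sym (length-map letterOf S)) (cong length e)

  Spells-drop : ∀ ρ Φ S → Spells S (srcₘ (inj₂ ρ ∷ Φ)) → Spells (drop (length (lhs ρ)) S) (srcₘ Φ)
  Spells-drop ρ Φ S e = trans (sym (drop-map (length (lhs ρ)) S))
                              (trans (cong (drop (length (lhs ρ))) e) (drop-++-length (lhs ρ) (srcₘ Φ) refl))

  Spells-runₘ : ∀ Φ S → Spells S (srcₘ Φ) → Spells (runₘ Φ S) (tgtₘ Φ)
  Spells-runₘ []            []      e = refl
  Spells-runₘ (inj₁ a ∷ Φ) (h ∷ S) e with ∷-injective e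
  ... | refl , e′ = cong (letterOf h ∷_) (Spells-runₘ Φ S e′)
  Spells-runₘ (inj₂ ρ ∷ Φ) S       e =
    trans (map-++ letterOf (outputs ρ _) _)
          (cong₂ _++_ (letters-outputs (rhs ρ)) (Spells-runₘ Φ _ (Spells-drop ρ Φ S e)))
    where
      letters-outputs : ∀ {W} cs → map letterOf (map (λ c → node ρ c W) cs) ≡ cs
      letters-outputs []       = refl
      letters-outputs (c ∷ cs) = cong (c ∷_) (letters-outputs cs)

  AtMost-runₘ : ∀ K Φ S → AtMost K S → Exact K Φ S → Spells S (srcₘ Φ) → AtMost (suc K) (runₘ Φ S)
  AtMost-runₘ K []            S       al       x       sp = []
  AtMost-runₘ K (inj₁ a ∷ Φ) (h ∷ S) (p ∷ al) x       sp =
    ≤-trans p (n≤1+n K) ∷ AtMost-runₘ K Φ S al x (proj₂ (∷-injective sp))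
  AtMost-runₘ K (inj₂ ρ ∷ Φ) S       al       (m , x) sp =
    All.++⁺ (outputs-AtMost ρ _ m) (AtMost-runₘ K Φ _ (All.drop⁺ (length (lhs ρ)) al) x (Spells-drop ρ Φ S sp))

  initial : Str R → List History
  initial = map leaf

  Spells-initial : ∀ s → Spells (initial s) s
  Spells-initial []      = refl
  Spells-initial (a ∷ s) = cong (a ∷_) (Spells-initial s)

  AtMost-initial : ∀ s → AtMost 0 (initial s)
  AtMost-initial []      = []
  AtMost-initial (a ∷ s) = z≤n ∷ AtMost-initial s

  -- Loath pairs

  infix 4 _⊑_
  _⊑_ : Multistep → Multistep → Set
  _⊑_ = _≤ₘ_ R

  -- Φ · Ψ is loath precisely when Ψ contracts a redex lying on letters that Φ leaves untouched.
  record LoathShape (Φ Ψ : Multistep) : Set where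
    constructor loathShape
    field
      Φ₁ Φ₂ Ψ₁ Ψ₂ : Multistep
      σ : Rule
      Φ≡ : Φ ≡ Φ₁ ++ idₘ (lhs σ) ++ Φ₂
      Ψ≡ : Ψ ≡ Ψ₁ ++ inj₂ σ ∷ Ψ₂
      left : tgtₘ Φ₁ ≡ srcₘ Ψ₁
      right : tgtₘ Φ₂ ≡ srcₘ Ψ₂

  ⊑-refl : ∀ Φ → Φ ⊑ Φ
  ⊑-refl []      = []≤
  ⊑-refl (x ∷ Φ) = keep x (⊑-refl Φ)

  resid-⊑-refl : ∀ Φ → resid R (⊑-refl Φ) ≡ idₘ (tgtₘ Φ)
  resid-⊑-refl []            = refl
  resid-⊑-refl (inj₁ a ∷ Φ) = cong (inj₁ a ∷_) (resid-⊑-refl Φ)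
  resid-⊑-refl (inj₂ ρ ∷ Φ) = trans (cong (idₘ (rhs ρ) ++_) (resid-⊑-refl Φ)) (sym (idₘ-++ (rhs ρ) _))

  ⊑-gap : ∀ Φ₁ σ Φ₂ → Φ₁ ++ idₘ (lhs σ) ++ Φ₂ ⊑ Φ₁ ++ inj₂ σ ∷ Φ₂
  ⊑-gap []      σ Φ₂ = drop≤ σ (⊑-refl Φ₂)
  ⊑-gap (x ∷ Φ₁) σ Φ₂ = keep x (⊑-gap Φ₁ σ Φ₂)

  resid-⊑-gap : ∀ Φ₁ σ Φ₂ → resid R (⊑-gap Φ₁ σ Φ₂) ≡ stepₘ (tgtₘ Φ₁ , σ , tgtₘ Φ₂)
  resid-⊑-gap []            σ Φ₂ = cong (inj₂ σ ∷_) (resid-⊑-refl Φ₂)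
  resid-⊑-gap (inj₁ a ∷ Φ₁) σ Φ₂ = cong (inj₁ a ∷_) (resid-⊑-gap Φ₁ σ Φ₂)
  resid-⊑-gap (inj₂ ρ ∷ Φ₁) σ Φ₂ =
    trans (cong (idₘ (rhs ρ) ++_) (resid-⊑-gap Φ₁ σ Φ₂))
          (trans (sym (++-assoc (idₘ (rhs ρ)) (idₘ (tgtₘ Φ₁)) _)) (cong (_++ _) (sym (idₘ-++ (rhs ρ) (tgtₘ Φ₁)))))

  idₘ-src-++-⊑ : ∀ Ψ {Z Z′} → Z ⊑ Z′ → idₘ (srcₘ Ψ) ++ Z ⊑ Ψ ++ Z′
  idₘ-src-++-⊑ []            q = q
  idₘ-src-++-⊑ (inj₁ a ∷ Ψ) q = keep (inj₁ a) (idₘ-src-++-⊑ Ψ q)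
  idₘ-src-++-⊑ (inj₂ ρ ∷ Ψ) {Z} q =
    subst (_⊑ _) (trans (sym (++-assoc (idₘ (lhs ρ)) _ Z)) (cong (_++ Z) (sym (idₘ-++ (lhs ρ) (srcₘ Ψ)))))
          (drop≤ ρ (idₘ-src-++-⊑ Ψ q))

  step-⊑ : ∀ Ψ₁ σ Ψ₂ → stepₘ (srcₘ Ψ₁ , σ , srcₘ Ψ₂) ⊑ Ψ₁ ++ inj₂ σ ∷ Ψ₂
  step-⊑ Ψ₁ σ Ψ₂ =
    idₘ-src-++-⊑ Ψ₁ (keep (inj₂ σ) (subst₂ _⊑_ (++-identityʳ _) (++-identityʳ Ψ₂) (idₘ-src-++-⊑ Ψ₂ []≤)))

  isStep-stepₘ : ∀ x → IsStep R (stepₘ x)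
  isStep-stepₘ (a , σ , b) = trans (#ρ-idₘ-++ a _) (cong suc (#ρ-idₘ b))

  LoathShape⇒Loath : ∀ {Φ Ψ} → LoathShape Φ Ψ → Loath R Φ Ψ
  LoathShape⇒Loath (loathShape Φ₁ Φ₂ Ψ₁ Ψ₂ σ refl refl e₁ e₂) =
    Φ₁ ++ inj₂ σ ∷ Φ₂ , ⊑-gap Φ₁ σ Φ₂ ,
    subst (IsStep R) (sym (resid-⊑-gap Φ₁ σ Φ₂)) (isStep-stepₘ (tgtₘ Φ₁ , σ , tgtₘ Φ₂)) ,
    subst (_⊑ _) (sym (trans (resid-⊑-gap Φ₁ σ Φ₂) (cong₂ (λ a b → stepₘ (a , σ , b)) e₁ e₂))) (step-⊑ Ψ₁ σ Ψ₂)

  resid-ruleFree : ∀ {Φ X} (p : Φ ⊑ X) → #ρ (resid R p) ≡ 0 → resid R p ≡ idₘ (tgtₘ Φ)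
  resid-ruleFree []≤              e = refl
  resid-ruleFree (keep (inj₁ a) p) e = cong (inj₁ a ∷_) (resid-ruleFree p e)
  resid-ruleFree (keep (inj₂ ρ) p) e =
    trans (cong (idₘ (rhs ρ) ++_) (resid-ruleFree p (trans (sym (#ρ-idₘ-++ (rhs ρ) _)) e)))
          (sym (idₘ-++ (rhs ρ) _))

  record StepResidual (Φ r : Multistep) : Set where
    constructor stepResidual
    field
      Φ₁ Φ₂ : Multistep
      σ : Rule
      Φ≡ : Φ ≡ Φ₁ ++ idₘ (lhs σ) ++ Φ₂
      r≡ : r ≡ stepₘ (tgtₘ Φ₁ , σ , tgtₘ Φ₂)

  resid-step : ∀ {Φ X} (p : Φ ⊑ X) → IsStep R (resid R p) → StepResidual Φ (resid R p)
  resid-step (keep (inj₁ a) p) e with resid-step p e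
  ... | stepResidual Φ₁ Φ₂ σ Φ≡ r≡ = stepResidual (inj₁ a ∷ Φ₁) Φ₂ σ (cong (inj₁ a ∷_) Φ≡) (cong (inj₁ a ∷_) r≡)
  resid-step (keep (inj₂ ρ) p) e with resid-step p (trans (sym (#ρ-idₘ-++ (rhs ρ) _)) e)
  ... | stepResidual Φ₁ Φ₂ σ Φ≡ r≡ =
    stepResidual (inj₂ ρ ∷ Φ₁) Φ₂ σ (cong (inj₂ ρ ∷_) Φ≡)
      (trans (cong (idₘ (rhs ρ) ++_) r≡)
             (trans (sym (++-assoc (idₘ (rhs ρ)) (idₘ (tgtₘ Φ₁)) _)) (cong (_++ _) (sym (idₘ-++ (rhs ρ) (tgtₘ Φ₁))))))
  resid-step (drop≤ ρ {Φ = Φ} p) e = stepResidual [] Φ ρ refl (cong (inj₂ ρ ∷_) (resid-ruleFree p (suc-injective e)))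

  idₘ-++-prefix : ∀ w u {A B} → (∀ {a Y} → B ≢ inj₁ a ∷ Y) → idₘ w ++ A ≡ idₘ u ++ B →
                  Σ (Str R) λ u₂ → u ≡ w ++ u₂ × A ≡ idₘ u₂ ++ B
  idₘ-++-prefix []      u       _  e = u , refl , e
  idₘ-++-prefix (c ∷ w) []      nl e = ⊥-elim (nl (sym e))
  idₘ-++-prefix (c ∷ w) (a ∷ u) nl e with ∷-injective e
  ... | refl , e′ = let u₂ , p , q = idₘ-++-prefix w u nl e′ in u₂ , cong (c ∷_) p , q

  idₘ-⊑⇒srcₘ : ∀ {A Ψ} → A ⊑ Ψ → ∀ v → A ≡ idₘ v → srcₘ Ψ ≡ v
  idₘ-⊑⇒srcₘ []≤         []      e = refl
  idₘ-⊑⇒srcₘ (keep x q)  (a ∷ v) e with ∷-injective e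
  ... | refl , e′ = cong (a ∷_) (idₘ-⊑⇒srcₘ q v e′)
  idₘ-⊑⇒srcₘ (drop≤ ρ q) v       e with idₘ-++-prefix (lhs ρ) v (λ ()) (trans e (sym (++-identityʳ _)))
  ... | v₂ , refl , e′ = cong (lhs ρ ++_) (idₘ-⊑⇒srcₘ q v₂ (trans e′ (++-identityʳ _)))

  step-⊑⇒shape : ∀ {A Ψ} → A ⊑ Ψ → ∀ u σ v → A ≡ stepₘ (u , σ , v) →
                 Σ Multistep λ Ψ₁ → Σ Multistep λ Ψ₂ → Ψ ≡ Ψ₁ ++ inj₂ σ ∷ Ψ₂ × srcₘ Ψ₁ ≡ u × srcₘ Ψ₂ ≡ v
  step-⊑⇒shape (keep x {Ψ = Ψ} q) []      σ v e with ∷-injective e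
  ... | refl , e′ = [] , Ψ , refl , refl , idₘ-⊑⇒srcₘ q v e′
  step-⊑⇒shape (keep x q)         (a ∷ u) σ v e with ∷-injective e
  ... | refl , e′ = let Ψ₁ , Ψ₂ , Ψ≡ , p₁ , p₂ = step-⊑⇒shape q u σ v e′ in
                    inj₁ a ∷ Ψ₁ , Ψ₂ , cong (inj₁ a ∷_) Ψ≡ , cong (a ∷_) p₁ , p₂
  step-⊑⇒shape (drop≤ ρ q)        u       σ v e with idₘ-++-prefix (lhs ρ) u (λ ()) e
  ... | u₂ , refl , e′ = let Ψ₁ , Ψ₂ , Ψ≡ , p₁ , p₂ = step-⊑⇒shape q u₂ σ v e′ in
                         inj₂ ρ ∷ Ψ₁ , Ψ₂ , cong (inj₂ ρ ∷_) Ψ≡ , cong (lhs ρ ++_) p₁ , p₂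

  Loath⇒LoathShape : ∀ {Φ Ψ} → Loath R Φ Ψ → LoathShape Φ Ψ
  Loath⇒LoathShape (X , p , isStep , q) with resid-step p isStep
  ... | stepResidual Φ₁ Φ₂ σ Φ≡ r≡ with step-⊑⇒shape q (tgtₘ Φ₁) σ (tgtₘ Φ₂) r≡
  ... | Ψ₁ , Ψ₂ , Ψ≡ , p₁ , p₂ = loathShape Φ₁ Φ₂ Ψ₁ Ψ₂ σ Φ≡ Ψ≡ (sym p₁) (sym p₂)

  -- The outputs of an exact redex have level K + 1, so a window of levels ≤ K in the
  -- result of an exact multistep can only come from letters left untouched.
  low-prefix-untouched : ∀ K Φ S h Tm T → Exact K Φ S → length S ≡ length (srcₘ Φ) →
                         runₘ Φ S ≡ h ∷ Tm ++ T → AtMost K (h ∷ Tm) →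
                         Σ (Str R) λ u → Σ Multistep λ Φ₂ → Φ ≡ idₘ u ++ Φ₂ × length u ≡ suc (length Tm)
  low-prefix-untouched K (inj₁ a ∷ Φ) (w ∷ S) h []        T x l e al = a ∷ [] , Φ , refl , refl
  low-prefix-untouched K (inj₁ a ∷ Φ) (w ∷ S) h (h′ ∷ Tm) T x l e (_ ∷ al)
    with low-prefix-untouched K Φ S h′ Tm T x (suc-injective l) (proj₂ (∷-injective e)) al
  ... | u , Φ₂ , Φ≡ , lu = a ∷ u , Φ₂ , cong (inj₁ a ∷_) Φ≡ , cong suc lu
  low-prefix-untouched K (inj₂ ρ ∷ Φ) S h Tm T (m , x) l e (p ∷ _) =
    ⊥-elim (too-high (trans (level-head-outputs ρ _ _ e) (cong suc m)) p)

  low-window-untouched : ∀ K Φ S T₁ h Tm T₂ → Exact K Φ S → length S ≡ length (srcₘ Φ) →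
                         runₘ Φ S ≡ T₁ ++ h ∷ Tm ++ T₂ → AtMost K (h ∷ Tm) →
                         Σ Multistep λ Φ₁ → Σ (Str R) λ u → Σ Multistep λ Φ₂ →
                         Φ ≡ Φ₁ ++ idₘ u ++ Φ₂ × length (tgtₘ Φ₁) ≡ length T₁ × length u ≡ suc (length Tm)
  low-window-untouched K Φ S [] h Tm T₂ x l e al with low-prefix-untouched K Φ S h Tm T₂ x l e al
  ... | u , Φ₂ , Φ≡ , lu = [] , u , Φ₂ , Φ≡ , refl , lu
  low-window-untouched K (inj₁ a ∷ Φ) (w ∷ S) (t ∷ T₁) h Tm T₂ x l e al
    with low-window-untouched K Φ S T₁ h Tm T₂ x (suc-injective l) (proj₂ (∷-injective e)) al
  ... | Φ₁ , u , Φ₂ , Φ≡ , l₁ , lu = inj₁ a ∷ Φ₁ , u , Φ₂ , cong (inj₁ a ∷_) Φ≡ , cong suc l₁ , lu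
  low-window-untouched K [] S (t ∷ T₁) h Tm T₂ x l () al
  low-window-untouched K (inj₁ a ∷ Φ) [] (t ∷ T₁) h Tm T₂ x () e al
  low-window-untouched K (inj₂ ρ ∷ Φ) S (t ∷ T₁) h Tm T₂ (m , x) l e (p ∷ al)
    with ++-∷-split (outputs ρ _) _ (t ∷ T₁) e
  ... | inj₂ (_ , _ , e′) = ⊥-elim (too-high (trans (level-outputs ρ _ e′) (cong suc m)) p)
  ... | inj₁ (T₁′ , T₁≡ , e′)
    with low-window-untouched K Φ _ T₁′ h Tm T₂ x
           (proj₂ (length-take-drop (length (lhs ρ)) _ S (trans l (length-++ (lhs ρ))))) e′ (p ∷ al)
  ... | Φ₁ , u , Φ₂ , Φ≡ , l₁ , lu =
    inj₂ ρ ∷ Φ₁ , u , Φ₂ , cong (inj₂ ρ ∷_) Φ≡ ,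
    trans (length-++ (rhs ρ))
          (trans (cong₂ _+_ (sym (length-map _ (rhs ρ))) l₁)
                 (sym (trans (cong length T₁≡) (length-++ (outputs ρ _))))) ,
    lu

  low-redex-untouched : ∀ K Φ S a σ b T₁ Tₘ T₂ → Exact K Φ S → length S ≡ length (srcₘ Φ) →
                        tgtₘ Φ ≡ a ++ lhs σ ++ b → runₘ Φ S ≡ T₁ ++ Tₘ ++ T₂ →
                        length T₁ ≡ length a → length Tₘ ≡ length (lhs σ) → AtMost K Tₘ →
                        Σ Multistep λ Φ₁ → Σ Multistep λ Φ₂ →
                        Φ ≡ Φ₁ ++ idₘ (lhs σ) ++ Φ₂ × a ≡ tgtₘ Φ₁ × b ≡ tgtₘ Φ₂
  low-redex-untouched K Φ S a σ b T₁ []       T₂ x l t≡ e l₁ lₘ al = ⊥-elim (length-lhs≢0 σ (sym lₘ))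
  low-redex-untouched K Φ S a σ b T₁ (h ∷ Tₘ) T₂ x l t≡ e l₁ lₘ al
    with low-window-untouched K Φ S T₁ h Tₘ T₂ x l e al
  ... | Φ₁ , u , Φ₂ , refl , lΦ₁ , lu
    with ++-injective (tgtₘ Φ₁) _ a _ (trans lΦ₁ l₁) (trans (sym (tgtₘ-gap Φ₁ u Φ₂)) t≡)
  ... | a≡ , e′ with ++-injective u _ (lhs σ) _ (trans lu lₘ) e′
  ... | refl , b≡ = Φ₁ , Φ₂ , refl , sym a≡ , sym b≡

  low-redex⇒Loath : ∀ K Φ S Ψ₁ σ Ψ₂ T₁ Tₘ T₂ → Exact K Φ S → length S ≡ length (srcₘ Φ) →
                    tgtₘ Φ ≡ srcₘ (Ψ₁ ++ inj₂ σ ∷ Ψ₂) →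
                    runₘ Φ S ≡ T₁ ++ Tₘ ++ T₂ → length T₁ ≡ length (srcₘ Ψ₁) → length Tₘ ≡ length (lhs σ) →
                    AtMost K Tₘ → Loath R Φ (Ψ₁ ++ inj₂ σ ∷ Ψ₂)
  low-redex⇒Loath K Φ S Ψ₁ σ Ψ₂ T₁ Tₘ T₂ x l t≡s e l₁ lₘ al
    with low-redex-untouched K Φ S (srcₘ Ψ₁) σ (srcₘ Ψ₂) T₁ Tₘ T₂ x l (trans t≡s (srcₘ-++ Ψ₁ _)) e l₁ lₘ al
  ... | Φ₁ , Φ₂ , Φ≡ , a≡ , b≡ = LoathShape⇒Loath (loathShape Φ₁ Φ₂ Ψ₁ Ψ₂ σ Φ≡ refl (sym a≡) (sym b≡))

  Exact-intro : ∀ K Ψ T → length T ≡ length (srcₘ Ψ) →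
                (∀ Ψ₁ σ Ψ₂ T₁ Tₘ T₂ → Ψ ≡ Ψ₁ ++ inj₂ σ ∷ Ψ₂ → T ≡ T₁ ++ Tₘ ++ T₂ →
                   length T₁ ≡ length (srcₘ Ψ₁) → length Tₘ ≡ length (lhs σ) → maxLevel Tₘ ≡ K) →
                Exact K Ψ T
  Exact-intro K []            T       l f = tt
  Exact-intro K (inj₁ a ∷ Ψ) (w ∷ T) l f =
    Exact-intro K Ψ T (suc-injective l) λ Ψ₁ σ Ψ₂ T₁ Tₘ T₂ Ψ≡ T≡ l₁ lₘ →
      f (inj₁ a ∷ Ψ₁) σ Ψ₂ (w ∷ T₁) Tₘ T₂ (cong (inj₁ a ∷_) Ψ≡) (cong (w ∷_) T≡) (cong suc l₁) lₘ
  Exact-intro K (inj₂ ρ ∷ Ψ) T       l f =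
    let n = length (lhs ρ)
        lₙ , l′ = length-take-drop n _ T (trans l (length-++ (lhs ρ)))
    in f [] ρ Ψ [] (take n T) (drop n T) refl (sym (take++drop≡id n T)) refl lₙ ,
       Exact-intro K Ψ (drop n T) l′ λ Ψ₁ σ Ψ₂ T₁ Tₘ T₂ Ψ≡ T≡ l₁ lₘ →
         f (inj₂ ρ ∷ Ψ₁) σ Ψ₂ (take n T ++ T₁) Tₘ T₂ (cong (inj₂ ρ ∷_) Ψ≡)
           (trans (sym (take++drop≡id n T)) (trans (cong (take n T ++_) T≡) (sym (++-assoc (take n T) T₁ _))))
           (trans (length-++ (take n T)) (trans (cong₂ _+_ lₙ l₁) (sym (length-++ (lhs ρ))))) lₘ

  ¬Loath⇒Exact : ∀ K Φ S Ψ → AtMost K S → Exact K Φ S → Spells S (srcₘ Φ) → tgtₘ Φ ≡ srcₘ Ψ →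
                 ¬ Loath R Φ Ψ → Exact (suc K) Ψ (runₘ Φ S)
  ¬Loath⇒Exact K Φ S Ψ al x sp t≡s nl =
    Exact-intro (suc K) Ψ (runₘ Φ S) (trans (runₘ-length Φ S l) (cong length t≡s)) redex-level
    where
      l : length S ≡ length (srcₘ Φ)
      l = Spells-length S sp
      redex-level : ∀ Ψ₁ σ Ψ₂ T₁ Tₘ T₂ → Ψ ≡ Ψ₁ ++ inj₂ σ ∷ Ψ₂ → runₘ Φ S ≡ T₁ ++ Tₘ ++ T₂ →
                    length T₁ ≡ length (srcₘ Ψ₁) → length Tₘ ≡ length (lhs σ) → maxLevel Tₘ ≡ suc K
      redex-level Ψ₁ σ Ψ₂ T₁ Tₘ T₂ Ψ≡ T≡ l₁ lₘ with maxLevel Tₘ ≟ suc K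
      ... | yes eq = eq
      ... | no ne =
        let ≤sK = maxLevel≤ Tₘ (All.++⁻ˡ Tₘ (All.++⁻ʳ T₁ (subst (AtMost (suc K)) T≡ (AtMost-runₘ K Φ S al x sp))))
            low = maxLevel≤⇒AtMost Tₘ (≤-pred (≤∧≢⇒< ≤sK ne))
        in ⊥-elim (nl (subst (Loath R Φ) (sym Ψ≡)
                     (low-redex⇒Loath K Φ S Ψ₁ σ Ψ₂ T₁ Tₘ T₂ x l (trans t≡s (cong srcₘ Ψ≡)) T≡ l₁ lₘ low)))

  Exact⇒¬Loath : ∀ K Φ S Ψ → AtMost K S → Spells S (srcₘ Φ) → Exact (suc K) Ψ (runₘ Φ S) → ¬ Loath R Φ Ψ
  Exact⇒¬Loath K Φ S Ψ al sp x lo with Loath⇒LoathShape lo | Spells-length S sp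
  ... | loathShape Φ₁ Φ₂ Ψ₁ Ψ₂ σ refl refl e₁ e₂ | l
    with split₃ S _ _ _ (trans l (length-srcₘ-gap Φ₁ (lhs σ) Φ₂))
  ... | S₁ , Sₘ , S₂ , refl , l₁ , lₘ , l₂ =
    -- the redex σ of Ψ reads Sₘ, which Φ left untouched, so its level is at most K
    let x′ = proj₂ (Exact-++⁻ (suc K) Ψ₁ (inj₂ σ ∷ Ψ₂) (runₘ Φ₁ S₁) (Sₘ ++ runₘ Φ₂ S₂)
                              (trans (runₘ-length Φ₁ S₁ l₁) (cong length e₁))
                              (subst (Exact (suc K) (Ψ₁ ++ inj₂ σ ∷ Ψ₂)) (runₘ-gap Φ₁ (lhs σ) Φ₂ S₁ Sₘ S₂ l₁ lₘ) x))
        m : maxLevel Sₘ ≡ suc K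
        m = trans (cong maxLevel (sym (take-++-length Sₘ (runₘ Φ₂ S₂) lₘ))) (proj₁ x′)
    in <-irrefl refl (subst (_≤ K) m (maxLevel≤ Sₘ (All.++⁻ˡ Sₘ (All.++⁻ʳ S₁ al))))

  -- Greedy chains are layered

  headₘ : Chain R → Multistep
  headₘ = headC R

  lastₘ : Chain R → Multistep
  lastₘ (last Φ) = Φ
  lastₘ (Φ ∷c c) = lastₘ c

  embC : Chain R → PT R
  embC = embChain R

  runC : Chain R → List History → List History
  runC c = run (embC c)

  Layered : ℕ → List History → Chain R → Set
  Layered K S (last Φ) = Exact K Φ S × Nonempty R Φ
  Layered K S (Φ ∷c c) = Exact K Φ S × Nonempty R Φ × tgtₘ Φ ≡ srcₘ (headₘ c) × Layered (suc K) (runₘ Φ S) c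

  Layered-head : ∀ K S c → Layered K S c → Exact K (headₘ c) S
  Layered-head K S (last Φ) (x , _) = x
  Layered-head K S (Φ ∷c c) (x , _) = x

  WFChain-⊢ : ∀ c → WFChain R c → embC c ⊢ srcₘ (headₘ c) ⇒ tgtₘ (lastₘ c)
  WFChain-⊢ (last Φ) _ = embₘ-⊢ Φ
  WFChain-⊢ (Φ ∷c c) (_ , e , wf) = t⊙ (embₘ-⊢ Φ) (retype (sym e) refl (WFChain-⊢ c wf))

  Layered⇒WFChain : ∀ K S c → Layered K S c → WFChain R c
  Layered⇒WFChain K S (last Φ) (_ , ne)          = ne
  Layered⇒WFChain K S (Φ ∷c c) (_ , ne , e , ly) = ne , e , Layered⇒WFChain (suc K) (runₘ Φ S) c ly

  Layered-⊢ : ∀ K S c → Layered K S c → embC c ⊢ srcₘ (headₘ c) ⇒ tgtₘ (lastₘ c)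
  Layered-⊢ K S c ly = WFChain-⊢ c (Layered⇒WFChain K S c ly)

  Spells-runC : ∀ K S c → Spells S (srcₘ (headₘ c)) → Layered K S c → Spells (runC c S) (tgtₘ (lastₘ c))
  Spells-runC K S (last Φ) sp _              = Spells-runₘ Φ S sp
  Spells-runC K S (Φ ∷c c) sp (_ , _ , e , ly) = Spells-runC (suc K) (runₘ Φ S) c (trans (Spells-runₘ Φ S sp) e) ly

  greedy⇒Layered : ∀ K S c → AtMost K S → Exact K (headₘ c) S → Spells S (srcₘ (headₘ c)) →
                   WFChain R c → GreedyChain R c → Layered K S c
  greedy⇒Layered K S (last Φ) al x sp ne _ = x , ne
  greedy⇒Layered K S (Φ ∷c c) al x sp (ne , e , wf) (nl , g) =
    x , ne , e ,
    greedy⇒Layered (suc K) (runₘ Φ S) c (AtMost-runₘ K Φ S al x sp)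
      (¬Loath⇒Exact K Φ S (headₘ c) al x sp e nl) (trans (Spells-runₘ Φ S sp) e) wf g

  Layered⇒GreedyChain : ∀ K S c → AtMost K S → Spells S (srcₘ (headₘ c)) → Layered K S c → GreedyChain R c
  Layered⇒GreedyChain K S (last Φ) al sp _ = tt
  Layered⇒GreedyChain K S (Φ ∷c c) al sp (x , _ , e , ly) =
    Exact⇒¬Loath K Φ S (headₘ c) al sp (Layered-head (suc K) (runₘ Φ S) c ly) ,
    Layered⇒GreedyChain (suc K) (runₘ Φ S) c (AtMost-runₘ K Φ S al x sp) (trans (Spells-runₘ Φ S sp) e) ly

  -- Uniqueness

  Reaches : ℕ → List History → Set
  Reaches n = Any (λ h → n ≤ level h)

  ¬Reaches-AtMost : ∀ K T → Reaches (suc K) T → ¬ AtMost K T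
  ¬Reaches-AtMost K (h ∷ T) (here p)  (q ∷ _)  = <-irrefl refl (≤-trans p q)
  ¬Reaches-AtMost K (h ∷ T) (there r) (_ ∷ al) = ¬Reaches-AtMost K T r al

  Reaches-runₘ : ∀ K Φ S → Exact K Φ S → Nonempty R Φ → length S ≡ length (srcₘ Φ) → Reaches (suc K) (runₘ Φ S)
  Reaches-runₘ K (inj₁ a ∷ Φ) (w ∷ S) x       ne l = there (Reaches-runₘ K Φ S x ne (suc-injective l))
  Reaches-runₘ K (inj₂ ρ ∷ Φ) S       (m , x) ne l = Any.++⁺ˡ (go (rhs ρ) (rhs-nonempty ρ))
    where
      go : ∀ cs → cs ≢ [] → Reaches (suc K) (map (λ c → node ρ c (take (length (lhs ρ)) S)) cs)
      go []      ne = ⊥-elim (ne refl)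
      go (c ∷ _) _  = here (≤-reflexive (cong suc (sym m)))

  Layered-reaches : ∀ K S c → Spells S (srcₘ (headₘ c)) → Layered K S c → Reaches (suc K) (runC c S)
  Layered-reaches K S (last Φ) sp (x , ne) = Reaches-runₘ K Φ S x ne (Spells-length S sp)
  Layered-reaches K S (Φ ∷c c) sp (x , ne , e , ly) =
    Any.map (≤-trans (n≤1+n (suc K))) (Layered-reaches (suc K) (runₘ Φ S) c (trans (Spells-runₘ Φ S sp) e) ly)

  outputs-++-injective : ∀ ρ σ W W′ X Y → outputs ρ W ++ X ≡ outputs σ W′ ++ Y → ρ ≡ σ × W ≡ W′
  outputs-++-injective ρ σ W W′ X Y = go (rhs ρ) (rhs σ) (rhs-nonempty ρ) (rhs-nonempty σ)
    where
      go : ∀ cs cs′ → cs ≢ [] → cs′ ≢ [] →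
           map (λ c → node ρ c W) cs ++ X ≡ map (λ c → node σ c W′) cs′ ++ Y → ρ ≡ σ × W ≡ W′
      go []      _        ne _  _ = ⊥-elim (ne refl)
      go (_ ∷ _) []       _  ne _ = ⊥-elim (ne refl)
      go (_ ∷ _) (_ ∷ _)  _  _  e with ∷-injective e
      ... | refl , _ = refl , refl

  -- A letter passes its history on unchanged (level ≤ K) while the outputs of a redex have
  -- level K + 1, so the result of an exact multistep tells letters and redexes apart.
  Exact-runₘ-injective : ∀ K Φ Ψ S S′ → AtMost K S → AtMost K S′ → Exact K Φ S → Exact K Ψ S′ →
                         Spells S (srcₘ Φ) → Spells S′ (srcₘ Ψ) → runₘ Φ S ≡ runₘ Ψ S′ → Φ ≡ Ψ × S ≡ S′
  Exact-runₘ-injective K [] [] [] [] _ _ _ _ _ _ _ = refl , refl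
  Exact-runₘ-injective K [] (inj₁ b ∷ Ψ) S (w′ ∷ S′) _ _ _ _ _ _ ()
  Exact-runₘ-injective K (inj₁ a ∷ Φ) [] (w ∷ S) S′ _ _ _ _ _ _ ()
  Exact-runₘ-injective K [] (inj₂ σ ∷ Ψ) S S′ _ _ _ _ _ _ e = ⊥-elim (outputs-++≢[] σ _ _ (sym e))
  Exact-runₘ-injective K (inj₂ ρ ∷ Φ) [] S S′ _ _ _ _ _ _ e = ⊥-elim (outputs-++≢[] ρ _ _ e)
  Exact-runₘ-injective K (inj₁ a ∷ Φ) (inj₁ b ∷ Ψ) (w ∷ S) (w′ ∷ S′) (_ ∷ al) (_ ∷ al′) x x′ sp sp′ e
    with ∷-injective e | ∷-injective sp | ∷-injective sp′
  ... | refl , e′ | refl , s | refl , s′ with Exact-runₘ-injective K Φ Ψ S S′ al al′ x x′ s s′ e′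
  ... | refl , refl = refl , refl
  Exact-runₘ-injective K (inj₁ a ∷ Φ) (inj₂ σ ∷ Ψ) (w ∷ S) S′ (p ∷ _) _ _ (m , _) _ _ e =
    ⊥-elim (too-high (trans (level-head-outputs σ _ _ (sym e)) (cong suc m)) p)
  Exact-runₘ-injective K (inj₂ ρ ∷ Φ) (inj₁ b ∷ Ψ) S (w′ ∷ S′) _ (p ∷ _) (m , _) _ _ _ e =
    ⊥-elim (too-high (trans (level-head-outputs ρ _ _ e) (cong suc m)) p)
  Exact-runₘ-injective K (inj₂ ρ ∷ Φ) (inj₂ σ ∷ Ψ) S S′ al al′ (_ , x) (_ , x′) sp sp′ e
    with outputs-++-injective ρ σ _ _ _ _ e
  ... | refl , W≡ with Exact-runₘ-injective K Φ Ψ (drop n S) (drop n S′) (All.drop⁺ n al) (All.drop⁺ n al′) x x′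
                         (Spells-drop ρ Φ S sp) (Spells-drop ρ Ψ S′ sp′)
                         (++-cancelˡ (outputs ρ (take n S)) _ _
                                     (trans e (cong (λ W → outputs ρ W ++ runₘ Ψ (drop n S′)) (sym W≡))))
    where n = length (lhs ρ)
  ... | refl , drop≡ =
    refl , trans (sym (take++drop≡id n S)) (trans (cong₂ _++_ W≡ drop≡) (take++drop≡id n S′))
    where n = length (lhs ρ)

  Layered-run-injective : ∀ K S S′ c c′ → AtMost K S → AtMost K S′ →
                          Spells S (srcₘ (headₘ c)) → Spells S′ (srcₘ (headₘ c′)) →
                          Layered K S c → Layered K S′ c′ → runC c S ≡ runC c′ S′ → c ≡ c′ × S ≡ S′
  Layered-run-injective K S S′ (last Φ) (last Ψ) al al′ sp sp′ (x , _) (x′ , _) e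
    with Exact-runₘ-injective K Φ Ψ S S′ al al′ x x′ sp sp′ e
  ... | refl , refl = refl , refl
  Layered-run-injective K S S′ (last Φ) (Ψ ∷c c′) al al′ sp sp′ (x , _) (x′ , _ , e′ , ly′) e =
    ⊥-elim (¬Reaches-AtMost (suc K) _
              (subst (Reaches (suc (suc K))) (sym e)
                     (Layered-reaches (suc K) (runₘ Ψ S′) c′ (trans (Spells-runₘ Ψ S′ sp′) e′) ly′))
              (AtMost-runₘ K Φ S al x sp))
  Layered-run-injective K S S′ (Φ ∷c c) (last Ψ) al al′ sp sp′ (x , _ , e₁ , ly) (x′ , _) e =
    ⊥-elim (¬Reaches-AtMost (suc K) _
              (subst (Reaches (suc (suc K))) e
                     (Layered-reaches (suc K) (runₘ Φ S) c (trans (Spells-runₘ Φ S sp) e₁) ly))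
              (AtMost-runₘ K Ψ S′ al′ x′ sp′))
  Layered-run-injective K S S′ (Φ ∷c c) (Ψ ∷c c′) al al′ sp sp′ (x , _ , e₁ , ly) (x′ , _ , e₁′ , ly′) e
    with Layered-run-injective (suc K) (runₘ Φ S) (runₘ Ψ S′) c c′
           (AtMost-runₘ K Φ S al x sp) (AtMost-runₘ K Ψ S′ al′ x′ sp′)
           (trans (Spells-runₘ Φ S sp) e₁) (trans (Spells-runₘ Ψ S′ sp′) e₁′) ly ly′ e
  ... | refl , run≡ with Exact-runₘ-injective K Φ Ψ S S′ al al′ x x′ sp sp′ run≡
  ... | refl , refl = refl , refl

  greedy⇒Layered-initial : ∀ c s → WFChain R c → GreedyChain R c → srcₘ (headₘ c) ≡ s → Layered 0 (initial s) c
  greedy⇒Layered-initial c s wf g e =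
    greedy⇒Layered 0 (initial s) c (AtMost-initial s) (Exact-zero (headₘ c) (initial s) (AtMost-initial s))
                   (trans (Spells-initial s) (sym e)) wf g

  -- An empty multistep runs the initial histories to themselves, whereas a chain produces level ≥ 1.
  idₘ≉chain : ∀ u c → WFChain R c → GreedyChain R c → ¬ embₘ (idₘ u) ≈ embC c
  idₘ≉chain u c wf g p with ⇒-unique (≈-⊢ p (idₘ-⊢ u)) (WFChain-⊢ c wf)
  ... | u≡ , _ =
    ¬Reaches-AtMost 0 (runC c (initial u))
      (Layered-reaches 0 (initial u) c (trans (Spells-initial u) u≡) (greedy⇒Layered-initial c u wf g (sym u≡)))
      (subst (AtMost 0) (trans (sym (runₘ-idₘ u (initial u) (length-map leaf u)))
                               (≈-run p (idₘ-⊢ u) _ (length-map leaf u)))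
             (AtMost-initial u))

  greedy-unique : ∀ m₁ m₂ → IsGreedyMSR R m₁ → IsGreedyMSR R m₂ → embMSR R m₁ ≈ embMSR R m₂ → m₁ ≡ m₂
  greedy-unique (emptyR u) (emptyR v) _ _ p = cong emptyR (proj₁ (⇒-unique (≈-⊢ p (idₘ-⊢ u)) (idₘ-⊢ v)))
  greedy-unique (emptyR u) (chain c) _ (wf , g) p = ⊥-elim (idₘ≉chain u c wf g p)
  greedy-unique (chain c) (emptyR v) (wf , g) _ p = ⊥-elim (idₘ≉chain v c wf g (≃sym p))
  greedy-unique (chain c₁) (chain c₂) (wf₁ , g₁) (wf₂ , g₂) p
    with ⇒-unique (≈-⊢ p (WFChain-⊢ c₁ wf₁)) (WFChain-⊢ c₂ wf₂)
  ... | src≡ , _ =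
    let s = srcₘ (headₘ c₁) in
    cong chain (proj₁ (Layered-run-injective 0 (initial s) (initial s) c₁ c₂ (AtMost-initial s) (AtMost-initial s)
                         (Spells-initial s) (trans (Spells-initial s) src≡)
                         (greedy⇒Layered-initial c₁ s wf₁ g₁ refl) (greedy⇒Layered-initial c₂ s wf₂ g₂ (sym src≡))
                         (≈-run p (WFChain-⊢ c₁ wf₁) (initial s) (length-map leaf s))))

  -- Existence

  srcₘ-stepₘ : ∀ x → srcₘ (stepₘ x) ≡ srcₛ x
  srcₘ-stepₘ (a , σ , b) = trans (srcₘ-++ (idₘ a) _) (cong₂ (λ p q → p ++ lhs σ ++ q) (srcₘ-idₘ a) (srcₘ-idₘ b))

  tgtₘ-stepₘ : ∀ x → tgtₘ (stepₘ x) ≡ tgtₛ x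
  tgtₘ-stepₘ (a , σ , b) = trans (tgtₘ-++ (idₘ a) _) (cong₂ (λ p q → p ++ rhs σ ++ q) (tgtₘ-idₘ a) (tgtₘ-idₘ b))

  stepₘ-⊢ : ∀ x → embₘ (stepₘ x) ⊢ srcₛ x ⇒ tgtₛ x
  stepₘ-⊢ x = retype (srcₘ-stepₘ x) (tgtₘ-stepₘ x) (embₘ-⊢ (stepₘ x))

  then-step-⊢ : ∀ Φ x → tgtₘ Φ ≡ srcₛ x → (embₘ Φ ⊙ embₘ (stepₘ x)) ⊢ srcₘ Φ ⇒ tgtₛ x
  then-step-⊢ Φ x e = t⊙ (retype refl e (embₘ-⊢ Φ)) (stepₘ-⊢ x)

  data StepSeq : Str R → Str R → Set where
    nil  : ∀ s → StepSeq s s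
    cons : ∀ {s u t} x → s ≡ srcₛ x → u ≡ tgtₛ x → StepSeq u t → StepSeq s t

  embₛ : ∀ {s t} → StepSeq s t → PT R
  embₛ (nil s)          = embₘ (idₘ s)
  embₛ (cons x _ _ q)   = embₘ (stepₘ x) ⊙ embₛ q

  embₛ-⊢ : ∀ {s t} (q : StepSeq s t) → embₛ q ⊢ s ⇒ t
  embₛ-⊢ (nil s)            = idₘ-⊢ s
  embₛ-⊢ (cons x e₁ e₂ q)   = t⊙ (retype (sym e₁) (sym e₂) (stepₘ-⊢ x)) (embₛ-⊢ q)

  _++ₛ_ : ∀ {s u t} → StepSeq s u → StepSeq u t → StepSeq s t
  nil s          ++ₛ r = r
  cons x e₁ e₂ q ++ₛ r = cons x e₁ e₂ (q ++ₛ r)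

  embₛ-++ₛ : ∀ {s u t} (q : StepSeq s u) (r : StepSeq u t) → embₛ (q ++ₛ r) ≈ (embₛ q ⊙ embₛ r)
  embₛ-++ₛ (nil s)          r = ≃sym (idₘ-unitˡ (embₛ-⊢ r))
  embₛ-++ₛ (cons x e₁ e₂ q) r =
    let dx = retype (sym e₁) (sym e₂) (stepₘ-⊢ x) in
    ≈-cong⊙ (≈-refl dx) (embₛ-++ₛ q r) dx (embₛ-⊢ (q ++ₛ r)) ∙ ≃sym (assoc⊙-≈ dx (embₛ-⊢ q) (embₛ-⊢ r))

  extendʳ : ∀ {s t} v → StepSeq s t → StepSeq (s ++ v) (t ++ v)
  extendʳ v (nil s) = nil (s ++ v)
  extendʳ v (cons (a , σ , b) e₁ e₂ q) =
    cons (a , σ , b ++ v) (trans (cong (_++ v) e₁) (assoc₃ a (lhs σ) b v))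
                          (trans (cong (_++ v) e₂) (assoc₃ a (rhs σ) b v)) (extendʳ v q)
    where
      assoc₃ : ∀ (a m b v : Str R) → (a ++ m ++ b) ++ v ≡ a ++ m ++ b ++ v
      assoc₃ a m b v = trans (++-assoc a (m ++ b) v) (cong (a ++_) (++-assoc m b v))

  extendˡ : ∀ {s t} u → StepSeq s t → StepSeq (u ++ s) (u ++ t)
  extendˡ u (nil s) = nil (u ++ s)
  extendˡ u (cons (a , σ , b) e₁ e₂ q) =
    cons (u ++ a , σ , b) (trans (cong (u ++_) e₁) (sym (++-assoc u a _)))
                          (trans (cong (u ++_) e₂) (sym (++-assoc u a _))) (extendˡ u q)

  extendʳ-≈ : ∀ {s t} v (q : StepSeq s t) → (embₛ q ⊗ embₘ (idₘ v)) ≈ embₛ (extendʳ v q)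
  extendʳ-≈ v (nil s) = ≃sym (embₘ-++ (idₘ s) (idₘ v)) ∙ ≡⇒≈ (sym (idₘ-++ s v))
  extendʳ-≈ v (cons (a , σ , b) e₁ e₂ q) =
    let dx = retype (sym e₁) (sym e₂) (stepₘ-⊢ (a , σ , b)) ; dq = embₛ-⊢ q in
    cong⊗ (≈-refl (t⊙ dx dq)) (≃sym (idₘ-unitˡ (idₘ-⊢ v)))
    ∙ ≃sym (exch-≈ dx (idₘ-⊢ v) dq (idₘ-⊢ v))
    ∙ ≈-cong⊙ (≃sym (embₘ-++ (stepₘ (a , σ , b)) (idₘ v)) ∙ ≡⇒≈ step-++)
              (extendʳ-≈ v q) (t⊗ dx (idₘ-⊢ v)) (t⊗ dq (idₘ-⊢ v))
    where
      step-++ : stepₘ (a , σ , b) ++ idₘ v ≡ stepₘ (a , σ , b ++ v)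
      step-++ = trans (++-assoc (idₘ a) _ (idₘ v)) (cong (λ X → idₘ a ++ inj₂ σ ∷ X) (sym (idₘ-++ b v)))

  extendˡ-≈ : ∀ {s t} u (q : StepSeq s t) → (embₘ (idₘ u) ⊗ embₛ q) ≈ embₛ (extendˡ u q)
  extendˡ-≈ u (nil s) = ≃sym (embₘ-++ (idₘ u) (idₘ s)) ∙ ≡⇒≈ (sym (idₘ-++ u s))
  extendˡ-≈ u (cons (a , σ , b) e₁ e₂ q) =
    let dx = retype (sym e₁) (sym e₂) (stepₘ-⊢ (a , σ , b)) ; dq = embₛ-⊢ q in
    cong⊗ (≃sym (idₘ-unitˡ (idₘ-⊢ u))) (≈-refl (t⊙ dx dq))
    ∙ ≃sym (exch-≈ (idₘ-⊢ u) dx (idₘ-⊢ u) dq)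
    ∙ ≈-cong⊙ (≃sym (embₘ-++ (idₘ u) (stepₘ (a , σ , b))) ∙ ≡⇒≈ ++-step)
              (extendˡ-≈ u q) (t⊗ (idₘ-⊢ u) dx) (t⊗ (idₘ-⊢ u) dq)
    where
      ++-step : idₘ u ++ stepₘ (a , σ , b) ≡ stepₘ (u ++ a , σ , b)
      ++-step = trans (sym (++-assoc (idₘ u) (idₘ a) _)) (cong (_++ _) (sym (idₘ-++ u a)))

  ≈-stepSeq : ∀ {γ s t} → γ ⊢ s ⇒ t → Σ (StepSeq s t) λ q → γ ≈ embₛ q
  ≈-stepSeq tε      = nil [] , ≈-refl tε
  ≈-stepSeq (tlt a) = nil (a ∷ []) , ≃sym (unitʳ-≈ (tlt a))
  ≈-stepSeq (trl ρ) =
    cons ([] , ρ , []) (sym (++-identityʳ _)) (sym (++-identityʳ _)) (nil (rhs ρ)) ,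
    (≃sym (unitʳ-≈ (trl ρ)) ∙ ≃sym (idₘ-unitʳ (rule-⊢ ρ)))
  ≈-stepSeq (t⊗ {s₂ = s₂} {t₁} d₁ d₂) with ≈-stepSeq d₁ | ≈-stepSeq d₂
  ... | q₁ , p₁ | q₂ , p₂ =
    extendʳ s₂ q₁ ++ₛ extendˡ t₁ q₂ ,
    (cong⊗ p₁ p₂
     ∙ cong⊗ (≃sym (idₘ-unitʳ (embₛ-⊢ q₁))) (≃sym (idₘ-unitˡ (embₛ-⊢ q₂)))
     ∙ ≃sym (exch-≈ (embₛ-⊢ q₁) (idₘ-⊢ s₂) (idₘ-⊢ t₁) (embₛ-⊢ q₂))
     ∙ ≈-cong⊙ (extendʳ-≈ s₂ q₁) (extendˡ-≈ t₁ q₂) (t⊗ (embₛ-⊢ q₁) (idₘ-⊢ s₂)) (t⊗ (idₘ-⊢ t₁) (embₛ-⊢ q₂))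
     ∙ ≃sym (embₛ-++ₛ (extendʳ s₂ q₁) (extendˡ t₁ q₂)))
  ≈-stepSeq (t⊙ d₁ d₂) with ≈-stepSeq d₁ | ≈-stepSeq d₂
  ... | q₁ , p₁ | q₂ , p₂ = q₁ ++ₛ q₂ , (≈-cong⊙ p₁ p₂ d₁ d₂ ∙ ≃sym (embₛ-++ₛ q₁ q₂))

  record StepAt (m : ℕ) (x : Step) (T : List History) : Set where
    constructor stepAt
    field
      T₁ Tₘ T₂ : List History
      T≡ : T ≡ T₁ ++ Tₘ ++ T₂
      length-T₁ : length T₁ ≡ length (proj₁ x)
      length-Tₘ : length Tₘ ≡ length (lhs (proj₁ (proj₂ x)))
      level-Tₘ : maxLevel Tₘ ≡ m

  StepAt-exists : ∀ x T → Spells T (srcₛ x) → Σ ℕ λ m → StepAt m x T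
  StepAt-exists (a , σ , b) T sp
    with split₃ T (length a) (length (lhs σ)) (length b)
                (trans (Spells-length T sp) (trans (length-++ a) (cong (length a +_) (length-++ (lhs σ)))))
  ... | T₁ , Tₘ , T₂ , T≡ , l₁ , lₘ , _ = maxLevel Tₘ , stepAt T₁ Tₘ T₂ T≡ l₁ lₘ refl

  StepAt⇒Exact : ∀ m x T → StepAt m x T → Exact m (stepₘ x) T
  StepAt⇒Exact m (a , σ , b) T (stepAt T₁ Tₘ T₂ refl l₁ lₘ mₘ) =
    Exact-++⁺ m (idₘ a) (inj₂ σ ∷ idₘ b) T₁ (Tₘ ++ T₂) (trans l₁ (sym (cong length (srcₘ-idₘ a)))) (Exact-idₘ m a T₁)
              (trans (cong maxLevel (take-++-length Tₘ T₂ lₘ)) mₘ , Exact-idₘ m b _)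

  StepAt-≤ : ∀ n m x T → AtMost n T → StepAt m x T → m ≤ n
  StepAt-≤ n m x T al (stepAt T₁ Tₘ T₂ refl _ _ mₘ) = subst (_≤ n) mₘ (maxLevel≤ Tₘ (All.++⁻ˡ Tₘ (All.++⁻ʳ T₁ al)))

  Nonempty-stepₘ : ∀ x → Nonempty R (stepₘ x)
  Nonempty-stepₘ x = ≤-reflexive (sym (isStep-stepₘ x))

  Nonempty-++-rule : ∀ Φ₁ σ Φ₂ → Nonempty R (Φ₁ ++ inj₂ σ ∷ Φ₂)
  Nonempty-++-rule Φ₁ σ Φ₂ = subst (1 ≤_) (sym (trans (#ρ-++ Φ₁ (inj₂ σ ∷ Φ₂)) (+-suc (#ρ Φ₁) (#ρ Φ₂)))) (s≤s z≤n)

  runₘ-stepₘ : ∀ a σ b S₁ Sₘ S₂ → length S₁ ≡ length a → length Sₘ ≡ length (lhs σ) → length S₂ ≡ length b →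
               runₘ (stepₘ (a , σ , b)) (S₁ ++ Sₘ ++ S₂) ≡ S₁ ++ outputs σ Sₘ ++ S₂
  runₘ-stepₘ a σ b S₁ Sₘ S₂ l₁ lₘ l₂ =
    trans (runₘ-++ (idₘ a) (inj₂ σ ∷ idₘ b) S₁ (Sₘ ++ S₂) (trans l₁ (sym (cong length (srcₘ-idₘ a)))))
          (cong₂ _++_ (runₘ-idₘ a S₁ l₁)
                 (cong₂ _++_ (cong (outputs σ) (take-++-length Sₘ S₂ lₘ))
                        (trans (cong (runₘ (idₘ b)) (drop-++-length Sₘ S₂ lₘ)) (runₘ-idₘ b S₂ l₂))))

  Exact-merge : ∀ K Φ₁ σ Φ₂ S₁ Sₘ S₂ → length S₁ ≡ length (srcₘ Φ₁) → length Sₘ ≡ length (lhs σ) →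
                Exact K (Φ₁ ++ idₘ (lhs σ) ++ Φ₂) (S₁ ++ Sₘ ++ S₂) → maxLevel Sₘ ≡ K →
                Exact K (Φ₁ ++ inj₂ σ ∷ Φ₂) (S₁ ++ Sₘ ++ S₂)
  Exact-merge K Φ₁ σ Φ₂ S₁ Sₘ S₂ l₁ lₘ x mₘ =
    let x₁ , x₂ = Exact-gap⁻ K Φ₁ (lhs σ) Φ₂ S₁ Sₘ S₂ l₁ lₘ x in
    Exact-++⁺ K Φ₁ (inj₂ σ ∷ Φ₂) S₁ (Sₘ ++ S₂) l₁ x₁
              (trans (cong maxLevel (take-++-length Sₘ S₂ lₘ)) mₘ ,
               subst (Exact K Φ₂) (sym (drop-++-length Sₘ S₂ lₘ)) x₂)

  record LowRedex (Φ : Multistep) (S : List History) (a : Str R) (σ : Rule) (b : Str R) (m : ℕ) : Set where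
    constructor lowRedex
    field
      Φ₁ Φ₂ : Multistep
      S₁ Sₘ S₂ : List History
      Φ≡ : Φ ≡ Φ₁ ++ idₘ (lhs σ) ++ Φ₂
      S≡ : S ≡ S₁ ++ Sₘ ++ S₂
      a≡ : a ≡ tgtₘ Φ₁
      b≡ : b ≡ tgtₘ Φ₂
      length-S₁ : length S₁ ≡ length (srcₘ Φ₁)
      length-Sₘ : length Sₘ ≡ length (lhs σ)
      length-S₂ : length S₂ ≡ length (srcₘ Φ₂)
      level-Sₘ : maxLevel Sₘ ≡ m

  low-redex : ∀ K Φ S a σ b m → Exact K Φ S → Spells S (srcₘ Φ) → tgtₘ Φ ≡ a ++ lhs σ ++ b →
              StepAt m (a , σ , b) (runₘ Φ S) → m ≤ K → LowRedex Φ S a σ b m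
  low-redex K Φ S a σ b m x sp t≡ (stepAt T₁ Tₘ T₂ T≡ l₁ lₘ mₘ) m≤K with Spells-length S sp
  ... | l with low-redex-untouched K Φ S a σ b T₁ Tₘ T₂ x l t≡ T≡ l₁ lₘ
                 (maxLevel≤⇒AtMost Tₘ (subst (_≤ K) (sym mₘ) m≤K))
  ... | Φ₁ , Φ₂ , refl , refl , refl
    with split₃ S _ _ _ (trans l (length-srcₘ-gap Φ₁ (lhs σ) Φ₂))
  ... | S₁ , Sₘ , S₂ , refl , lS₁ , lSₘ , lS₂
    with ++-injective (runₘ Φ₁ S₁) _ T₁ _ (trans (runₘ-length Φ₁ S₁ lS₁) (sym l₁))
                      (trans (sym (runₘ-gap Φ₁ (lhs σ) Φ₂ S₁ Sₘ S₂ lS₁ lSₘ)) T≡)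
  ... | _ , e with ++-injective Sₘ _ Tₘ _ (trans lSₘ (sym lₘ)) e
  ... | Sₘ≡Tₘ , _ = lowRedex Φ₁ Φ₂ S₁ Sₘ S₂ refl refl refl refl lS₁ lSₘ lS₂ (trans (cong maxLevel Sₘ≡Tₘ) mₘ)

  data AfterLayer (K : ℕ) (Φ : Multistep) (S : List History) (x : Step) (m : ℕ) : Set where
    merged   : (X : Multistep) → Exact K X S → Nonempty R X → srcₘ X ≡ srcₘ Φ → tgtₘ X ≡ tgtₛ x →
               runₘ X S ≡ runₘ (stepₘ x) (runₘ Φ S) → (embₘ Φ ⊙ embₘ (stepₘ x)) ≈ embₘ X →
               AfterLayer K Φ S x m
    commuted : (x′ : Step) (Ψ : Multistep) → m < K → StepAt m x′ S → srcₛ x′ ≡ srcₘ Φ → tgtₛ x′ ≡ srcₘ Ψ →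
               tgtₘ Ψ ≡ tgtₛ x → Exact K Ψ (runₘ (stepₘ x′) S) → Nonempty R Ψ →
               runₘ Ψ (runₘ (stepₘ x′) S) ≡ runₘ (stepₘ x) (runₘ Φ S) →
               (embₘ Φ ⊙ embₘ (stepₘ x)) ≈ (embₘ (stepₘ x′) ⊙ embₘ Ψ) → AfterLayer K Φ S x m

  -- A step whose redex has level m ≤ K reads only letters left untouched by the layer Φ: for m = K
  -- it joins Φ, for m < K it commutes before Φ.
  step-after-layer : ∀ K Φ S x m → Spells S (srcₘ Φ) → Exact K Φ S → Nonempty R Φ → tgtₘ Φ ≡ srcₛ x →
                     StepAt m x (runₘ Φ S) → m ≤ K → AfterLayer K Φ S x m
  step-after-layer K Φ S (a , σ , b) m sp xΦ ne t≡ st m≤K with low-redex K Φ S a σ b m xΦ sp t≡ st m≤K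
  ... | lowRedex Φ₁ Φ₂ S₁ Sₘ S₂ refl refl refl refl l₁ lₘ l₂ mₘ with m ≟ K
  ... | yes refl =
    merged (Φ₁ ++ inj₂ σ ∷ Φ₂) (Exact-merge K Φ₁ σ Φ₂ S₁ Sₘ S₂ l₁ lₘ xΦ mₘ) (Nonempty-++-rule Φ₁ σ Φ₂)
           (trans (srcₘ-++ Φ₁ _) (sym (srcₘ-gap Φ₁ (lhs σ) Φ₂))) (tgtₘ-++ Φ₁ _)
           (sym (≈-run (absorb-step Φ₁ σ Φ₂) (then-step-⊢ _ _ t≡) _ (Spells-length _ sp))) (absorb-step Φ₁ σ Φ₂)
  ... | no m≢K =
    let x′ = (srcₘ Φ₁ , σ , srcₘ Φ₂)
        x₁ , x₂ = Exact-gap⁻ K Φ₁ (lhs σ) Φ₂ S₁ Sₘ S₂ l₁ lₘ xΦ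
        swap = absorb-step Φ₁ σ Φ₂ ∙ ≃sym (extract-step Φ₁ σ Φ₂)
    in commuted x′ (Φ₁ ++ idₘ (rhs σ) ++ Φ₂) (≤∧≢⇒< m≤K m≢K) (stepAt S₁ Sₘ S₂ refl l₁ lₘ mₘ)
         (sym (srcₘ-gap Φ₁ (lhs σ) Φ₂)) (sym (srcₘ-gap Φ₁ (rhs σ) Φ₂)) (tgtₘ-gap Φ₁ (rhs σ) Φ₂)
         (subst (Exact K (Φ₁ ++ idₘ (rhs σ) ++ Φ₂)) (sym (runₘ-stepₘ (srcₘ Φ₁) σ (srcₘ Φ₂) S₁ Sₘ S₂ l₁ lₘ l₂))
                (Exact-gap⁺ K Φ₁ (rhs σ) Φ₂ S₁ (outputs σ Sₘ) S₂ l₁ (length-map _ (rhs σ)) x₁ x₂))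
         (subst (1 ≤_) (trans (#ρ-gap Φ₁ (lhs σ) Φ₂) (sym (#ρ-gap Φ₁ (rhs σ) Φ₂))) ne)
         (sym (≈-run swap (then-step-⊢ _ _ t≡) _ (Spells-length _ sp))) swap

  data Insertion (K : ℕ) (S : List History) (c : Chain R) (x : Step) (m : ℕ) : Set where
    absorbed : (c′ : Chain R) → Layered K S c′ → srcₘ (headₘ c′) ≡ srcₘ (headₘ c) → tgtₘ (lastₘ c′) ≡ tgtₛ x →
               (embC c ⊙ embₘ (stepₘ x)) ≈ embC c′ → Insertion K S c x m
    passed   : (x′ : Step) (c′ : Chain R) → m < K → StepAt m x′ S → srcₛ x′ ≡ srcₘ (headₘ c) →
               tgtₛ x′ ≡ srcₘ (headₘ c′) → Layered K (runₘ (stepₘ x′) S) c′ → tgtₘ (lastₘ c′) ≡ tgtₛ x →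
               (embC c ⊙ embₘ (stepₘ x)) ≈ (embₘ (stepₘ x′) ⊙ embC c′) → Insertion K S c x m

  ≈-reassoc : ∀ {γ δ ζ η s t u v} → γ ⊢ s ⇒ t → δ ⊢ t ⇒ u → ζ ⊢ u ⇒ v → (δ ⊙ ζ) ≈ η → ((γ ⊙ δ) ⊙ ζ) ≈ (γ ⊙ η)
  ≈-reassoc dγ dδ dζ p = assoc⊙-≈ dγ dδ dζ ∙ ≈-cong⊙ (≈-refl dγ) p dγ (t⊙ dδ dζ)

  ≈-slide : ∀ {γ δ ζ ζ′ δ′ s t u v w} → γ ⊢ s ⇒ t → δ ⊢ t ⇒ u → ζ ⊢ u ⇒ v → ζ′ ⊢ t ⇒ w → δ′ ⊢ w ⇒ v →
            (δ ⊙ ζ) ≈ (ζ′ ⊙ δ′) → ((γ ⊙ δ) ⊙ ζ) ≈ ((γ ⊙ ζ′) ⊙ δ′)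
  ≈-slide dγ dδ dζ dζ′ dδ′ p = ≈-reassoc dγ dδ dζ p ∙ ≃sym (assoc⊙-≈ dγ dζ′ dδ′)

  insert-step : ∀ K S c x m → AtMost K S → Spells S (srcₘ (headₘ c)) → Layered K S c → tgtₘ (lastₘ c) ≡ srcₛ x →
                StepAt m x (runC c S) → Insertion K S c x m
  insert-step K S (last Φ) x m al sp (xΦ , ne) t≡ st with m ≟ suc K
  ... | yes refl =
    absorbed (Φ ∷c last (stepₘ x))
             (xΦ , ne , trans t≡ (sym (srcₘ-stepₘ x)) , StepAt⇒Exact _ x _ st , Nonempty-stepₘ x)
             refl (tgtₘ-stepₘ x) (≈-refl (then-step-⊢ Φ x t≡))
  ... | no m≢sK with step-after-layer K Φ S x m sp xΦ ne t≡ st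
                       (≤-pred (≤∧≢⇒< (StepAt-≤ (suc K) m x _ (AtMost-runₘ K Φ S al xΦ sp) st) m≢sK))
  ... | merged X xX neX srcX tgtX _ p = absorbed (last X) (xX , neX) srcX tgtX p
  ... | commuted x′ Ψ m<K st′ src′ tgt′ tgtΨ xΨ neΨ _ p = passed x′ (last Ψ) m<K st′ src′ tgt′ (xΨ , neΨ) tgtΨ p
  insert-step K S (Φ ∷c c) x m al sp (xΦ , ne , e , ly) t≡ st
    with insert-step (suc K) (runₘ Φ S) c x m (AtMost-runₘ K Φ S al xΦ sp)
                     (trans (Spells-runₘ Φ S sp) e) ly t≡ st
  ... | absorbed c′ ly′ src′ tgt′ p =
    let dΦ = embₘ-⊢ Φ
        dc = retype (sym e) refl (Layered-⊢ (suc K) _ c ly)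
        dx = retype (sym t≡) refl (stepₘ-⊢ x)
    in absorbed (Φ ∷c c′) (xΦ , ne , trans e (sym src′) , ly′) refl tgt′ (≈-reassoc dΦ dc dx p)
  ... | passed x₁ c′ m<sK st₁ src₁ tgt₁ ly′ tgt′ p
    with step-after-layer K Φ S x₁ m sp xΦ ne (trans e (sym src₁)) st₁ (≤-pred m<sK)
  ... | merged X xX neX srcX tgtX runX pX =
    let dΦ = embₘ-⊢ Φ
        dc = retype (sym e) refl (Layered-⊢ (suc K) _ c ly)
        dx = retype (sym t≡) refl (stepₘ-⊢ x)
        dx₁ = retype (trans src₁ (sym e)) refl (stepₘ-⊢ x₁)
        dc′ = retype (sym tgt₁) tgt′ (Layered-⊢ (suc K) _ c′ ly′)
    in absorbed (X ∷c c′) (xX , neX , trans tgtX tgt₁ , subst (λ T → Layered (suc K) T c′) (sym runX) ly′) srcX tgt′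
         (≈-slide dΦ dc dx dx₁ dc′ p ∙ ≈-cong⊙ pX (≈-refl dc′) (t⊙ dΦ dx₁) dc′)
  ... | commuted x′ Ψ m<K st′ src′ tgt′′ tgtΨ xΨ neΨ runΨ pΨ =
    let dΦ = embₘ-⊢ Φ
        dc = retype (sym e) refl (Layered-⊢ (suc K) _ c ly)
        dx = retype (sym t≡) refl (stepₘ-⊢ x)
        dx₁ = retype (trans src₁ (sym e)) refl (stepₘ-⊢ x₁)
        dc′ = retype (sym tgt₁) tgt′ (Layered-⊢ (suc K) _ c′ ly′)
        dx′ = retype src′ refl (stepₘ-⊢ x′)
        dΨ = retype (sym tgt′′) tgtΨ (embₘ-⊢ Ψ)
    in passed x′ (Ψ ∷c c′) m<K st′ src′ tgt′′
         (xΨ , neΨ , trans tgtΨ tgt₁ , subst (λ T → Layered (suc K) T c′) (sym runΨ) ly′) tgt′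
         (≈-slide dΦ dc dx dx₁ dc′ p ∙ ≈-cong⊙ pΨ (≈-refl dc′) (t⊙ dΦ dx₁) dc′ ∙ assoc⊙-≈ dx′ dΨ dc′)

  record LayeredChain (s t : Str R) : Set where
    constructor layeredChain
    field
      layers : Chain R
      layered : Layered 0 (initial s) layers
      src≡ : srcₘ (headₘ layers) ≡ s
      tgt≡ : tgtₘ (lastₘ layers) ≡ t

    ⊢layers : embC layers ⊢ s ⇒ t
    ⊢layers = retype src≡ tgt≡ (Layered-⊢ 0 (initial s) layers layered)

  open LayeredChain

  insert-steps : ∀ {s u t} (c : LayeredChain s u) (q : StepSeq u t) →
                 Σ (LayeredChain s t) λ c′ → (embC (layers c) ⊙ embₛ q) ≈ embC (layers c′)
  insert-steps c (nil u) = c , idₘ-unitʳ (⊢layers c)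
  insert-steps {s} c@(layeredChain cs ly src≡ tgt≡) (cons x e₁ e₂ q)
    with StepAt-exists x (runC cs (initial s))
                       (trans (Spells-runC 0 _ cs (trans (Spells-initial s) (sym src≡)) ly) (trans tgt≡ e₁))
  ... | m , st
    with insert-step 0 (initial s) cs x m (AtMost-initial s) (trans (Spells-initial s) (sym src≡)) ly
                     (trans tgt≡ e₁) st
  ... | passed _ _ () _ _ _ _ _ _
  ... | absorbed c₁ ly₁ src₁ tgt₁ p₁
    with insert-steps (layeredChain c₁ ly₁ (trans src₁ src≡) (trans tgt₁ (sym e₂))) q
  ... | c₂ , p₂ =
    let dx = retype (sym e₁) refl (stepₘ-⊢ x)
        dq = retype e₂ refl (embₛ-⊢ q)
    in c₂ , (≃sym (assoc⊙-≈ (⊢layers c) dx dq) ∙ ≈-cong⊙ p₁ (≈-refl dq) (t⊙ (⊢layers c) dx) dq ∙ p₂)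

  step-chain : ∀ {s u} x → s ≡ srcₛ x → u ≡ tgtₛ x → LayeredChain s u
  step-chain {s} x e₁ e₂ =
    layeredChain (last (stepₘ x)) (Exact-zero (stepₘ x) (initial s) (AtMost-initial s) , Nonempty-stepₘ x)
                 (trans (srcₘ-stepₘ x) (sym e₁)) (trans (tgtₘ-stepₘ x) (sym e₂))

  LayeredChain-greedy : ∀ {s t} (c : LayeredChain s t) → IsGreedyMSR R (chain (layers c))
  LayeredChain-greedy {s} (layeredChain c ly src≡ _) =
    Layered⇒WFChain 0 (initial s) c ly ,
    Layered⇒GreedyChain 0 (initial s) c (AtMost-initial s) (trans (Spells-initial s) (sym src≡)) ly

  greedy-exists : ∀ {γ s t} → γ ⊢ s ⇒ t → Σ (MSR R) λ m → IsGreedyMSR R m × γ ≈ embMSR R m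
  greedy-exists d with ≈-stepSeq d
  ... | nil s , p = emptyR s , (tt , tt) , p
  ... | cons x e₁ e₂ q , p with insert-steps (step-chain x e₁ e₂) q
  ... | c , p′ = chain (layers c) , LayeredChain-greedy c , (p ∙ p′)

theorem35 : (R : SRS) (γ : PT R) → IsProofTerm R γ →
    Σ (MSR R) λ γ' → (IsGreedyMSR R γ' × _≃_ R γ (embMSR R γ'))
      × ((γ'' : MSR R) → IsGreedyMSR R γ'' → _≃_ R γ (embMSR R γ'') → γ'' ≡ γ')
theorem35 R γ (_ , _ , d) with greedy-exists R d
... | γ′ , greedy , γ≃γ′ =
  γ′ , (greedy , γ≃γ′) ,
  λ γ″ greedy″ γ≃γ″ → greedy-unique R γ″ γ′ greedy″ greedy (≃trans (≃sym γ≃γ″) γ≃γ′)
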